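{- Let $N\ge 4$ be even and let $m=\frac{N}{2}$. Let $H_{N+1}$ be the $(m+1)\times(m+1)$ matrix with entries \[ H_{N+1}(i,j)=\begin{cases} 3 & \text{if } i=j\le m,\\ N & \text{if } i=j=m+1,\\ -1 & \text{if } |i-j|=1 \text{ and } (i,j)\neq(m,m-1),\ \text{or if } j=m+1,\ 1\le i\le m,\\ -2 & \text{if } i=m+1,\ 1\le j\le m-1,\ \text{or if } (i,j)=(m,m-1),\\ 0 & \text{otherwise}. \end{cases} \] Then $H_{N+1}$ is invertible and \[ H_{N+1}^{ -1}(i,j)=\frac{1}{L_{N-1}+L_{N+1}}\begin{cases} 2(L_N-L_{N-2i})+L_{N-2j}(L_{2i}-2) & \text{if } 1\le i\le j\le m-1,\\ 2(L_N-L_{N-2j})+L_{N-2i}(L_{2j}-2) & \text{if } 1\le j<i\le m,\\ L_N-L_{N-2i}+L_{2i}-2 & \text{if } j=m,\ 1\le i\le m,\\ 2(L_N-L_{N-2j}) & \text{if } i=m+1,\ 1\le j\le m-1,\\ L_N-2 & \text{if } (i,j)=(m+1,m),\\ L_N-L_{N-2i} & \text{if } j=m+1,\ 1\le i\le m,\\ L_N & \text{if } i=j=m+1. \end{cases} \]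
   Context: $L_n$ denotes the Lucas numbers ($L_0=2$, $L_1=1$, $L_{n+2}=L_{n+1}+L_n$). -}

module Defs where

open import Data.Nat as ℕ using (ℕ; zero; suc; _∸_; _≡ᵇ_; _≤ᵇ_; _<ᵇ_; NonZero)
open import Data.Integer using (+_; -_)
open import Data.Rational using (ℚ; _/_; 0ℚ; 1ℚ) renaming (_+_ to _+q_; _*_ to _*q_; _-_ to _-q_)
open import Data.Fin using (Fin; zero; suc; toℕ)
open import Data.Bool using (Bool; true; false; if_then_else_; _∧_; _∨_)

Lucas : ℕ → ℕ
Lucas zero = 2
Lucas (suc zero) = 1
Lucas (suc (suc n)) = Lucas (suc n) ℕ.+ Lucas n

ι : ℕ → ℚ
ι n = (+ n) / 1

Lq : ℕ → ℚ
Lq n = ι (Lucas n)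

Σ : (n : ℕ) → (Fin n → ℚ) → ℚ
Σ zero f = 0ℚ
Σ (suc n) f = f zero +q Σ n (λ k → f (suc k))

Matrix : ℕ → Set
Matrix n = Fin n → Fin n → ℚ

_⊗_ : {n : ℕ} → Matrix n → Matrix n → Matrix n
_⊗_ {n} A B i j = Σ n (λ k → A i k *q B k j)

Id : (n : ℕ) → Matrix n
Id n i j = if toℕ i ≡ᵇ toℕ j then 1ℚ else 0ℚ

-- entry H_{N+1}(i,j) with N = 2m, 1-based indices i j ∈ {1..m+1}
Hentry : ℕ → ℕ → ℕ → ℚ
Hentry m i j =
  if (i ≡ᵇ j) ∧ (i ≤ᵇ m) then ι 3
  else if (i ≡ᵇ suc m) ∧ (j ≡ᵇ suc m) then ι (2 ℕ.* m)
  else if (i ≡ᵇ m) ∧ (j ≡ᵇ m ∸ 1) then - (+ 2) / 1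
  else if (suc i ≡ᵇ j) ∨ (suc j ≡ᵇ i) then - (+ 1) / 1
  else if (j ≡ᵇ suc m) ∧ (1 ≤ᵇ i) ∧ (i ≤ᵇ m) then - (+ 1) / 1
  else if (i ≡ᵇ suc m) ∧ (1 ≤ᵇ j) ∧ (j ≤ᵇ m ∸ 1) then - (+ 2) / 1
  else 0ℚ

-- (L_{N-1} + L_{N+1}) times the claimed entry H_{N+1}^{-1}(i,j), N = 2m, 1-based indices
Kentry : ℕ → ℕ → ℕ → ℚ
Kentry m i j =
  if (1 ≤ᵇ i) ∧ (i ≤ᵇ j) ∧ (j ≤ᵇ m ∸ 1) then
    ι 2 *q (Lq N -q Lq (N ∸ 2 ℕ.* i)) +q Lq (N ∸ 2 ℕ.* j) *q (Lq (2 ℕ.* i) -q ι 2)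
  else if (1 ≤ᵇ j) ∧ (j <ᵇ i) ∧ (i ≤ᵇ m) then
    ι 2 *q (Lq N -q Lq (N ∸ 2 ℕ.* j)) +q Lq (N ∸ 2 ℕ.* i) *q (Lq (2 ℕ.* j) -q ι 2)
  else if (j ≡ᵇ m) ∧ (1 ≤ᵇ i) ∧ (i ≤ᵇ m) then
    Lq N -q Lq (N ∸ 2 ℕ.* i) +q Lq (2 ℕ.* i) -q ι 2
  else if (i ≡ᵇ suc m) ∧ (1 ≤ᵇ j) ∧ (j ≤ᵇ m ∸ 1) then
    ι 2 *q (Lq N -q Lq (N ∸ 2 ℕ.* j))
  else if (i ≡ᵇ suc m) ∧ (j ≡ᵇ m) then
    Lq N -q ι 2
  else if (j ≡ᵇ suc m) ∧ (1 ≤ᵇ i) ∧ (i ≤ᵇ m) then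
    Lq N -q Lq (N ∸ 2 ℕ.* i)
  else if (i ≡ᵇ suc m) ∧ (j ≡ᵇ suc m) then
    Lq N
  else 0ℚ
  where
  N : ℕ
  N = 2 ℕ.* m

nz+ : ∀ a b → NonZero a → NonZero (a ℕ.+ b)
nz+ (suc a) b _ = _

Lucas-nz : ∀ n → NonZero (Lucas n)
Lucas-nz zero = _
Lucas-nz (suc zero) = _
Lucas-nz (suc (suc n)) = nz+ (Lucas (suc n)) (Lucas n) (Lucas-nz (suc n))

den : ℕ → ℕ
den N = Lucas (N ∸ 1) ℕ.+ Lucas (suc N)

den-nz : ∀ N → NonZero (den N)
den-nz N = nz+ (Lucas (N ∸ 1)) _ (Lucas-nz (N ∸ 1))

H : (m : ℕ) → Matrix (suc m)
H m i j = Hentry m (suc (toℕ i)) (suc (toℕ j))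

Hinv : (m : ℕ) → Matrix (suc m)
Hinv m i j = (+ 1 / den (2 ℕ.* m)) {{den-nz (2 ℕ.* m)}} *q Kentry m (suc (toℕ i)) (suc (toℕ j))

-- Write L for the Lucas numbers, N = 2m, and number rows and columns 1 … m+1.
-- Both k ↦ L(2k) and k ↦ L(N−2k) solve u(k+2) = 3u(k+1) − u(k), and their
-- Casoratian is the constant L(N−1) + L(N+1) = D.  Rows 1 … m−1 of H send a
-- column x to 3x(k) − x(k−1) − x(k+1) − x(m+1).  On either side of its diagonal
-- entry, each column of the claimed inverse K is c + α L(N−2k) + β L(2k) with c
-- its last entry, so these rows give 0 off the diagonal and the jump of the two
-- affine pieces, which is the Casoratian D, on it.  Rows m and m+1 are checked
-- at the boundary, the dense row m+1 after telescoping it against the others.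
-- Hence H K = D · I.  Finally, H and K become symmetric once their last two
-- columns are doubled, which turns K H into a rescaled transpose of H K.

module Submission where

open import Defs
open import Data.Nat using (ℕ; suc; _≤_)
open import Data.Fin using (Fin)
open import Data.Product using (_×_)
open import Relation.Binary.PropositionalEquality using (_≡_)

open import Data.Bool using (true; false; T; if_then_else_; _∧_; _∨_)
open import Data.Bool.Properties using (∧-zeroʳ; ∨-zeroʳ)
open import Data.Fin using (zero; suc; toℕ)
open import Data.Fin.Properties using (toℕ<n; toℕ-injective)
import Data.Integer as ℤ
import Data.Integer.Properties as ℤₚ
open import Data.List using ([]; _∷_; foldr)
open import Data.List.Relation.Unary.All using (All; []; _∷_)
import Data.List.Relation.Unary.AllPairs as AllPairs
open import Data.List.Relation.Unary.AllPairs using ([]; _∷_)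
open import Data.List.Relation.Unary.Linked using (Linked; [-]; _∷_)
open import Data.List.Relation.Unary.Linked.Properties using (Linked⇒AllPairs)
open import Data.List.Relation.Unary.Unique.Propositional using (Unique)
open import Data.Nat as ℕ using (zero; _<_; _∸_; _≡ᵇ_; _≤ᵇ_; _<ᵇ_; z≤n; s≤s)
import Data.Nat.Properties as ℕₚ
open import Data.Nat.Coprimality using (1-coprimeTo) renaming (sym to coprime-sym)
open import Data.Product using (_,_)
open import Data.Rational using (ℚ; mkℚ; toℚᵘ; 0ℚ; 1ℚ; _/_; _+_; _*_; _-_; -_; 1/_; NonZero)
open import Data.Rational.Properties as ℚₚ using (+-*-commutativeRing)
open import Data.Rational.Unnormalised as ℚᵘ using (*≡*)
import Data.Rational.Unnormalised.Properties as ℚᵘₚ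
open import Data.Sum using (_⊎_; inj₁; inj₂)
open import Function using (_∘_)
open import Relation.Binary.Definitions using (Tri; tri<; tri≈; tri>)
open import Relation.Binary.PropositionalEquality using (_≢_; refl; sym; trans; cong; cong₂; module ≡-Reasoning)
open import Relation.Nullary using (¬_; yes; no; contradiction)
open import Relation.Nullary.Decidable using (dec⇒maybe)
open import Tactic.RingSolver using (solve-∀)
open import Tactic.RingSolver.Core.AlmostCommutativeRing using (AlmostCommutativeRing; fromCommutativeRing)

open ≡-Reasoning

T⇒≡true : ∀ {b} → T b → b ≡ true
T⇒≡true {true} _ = refl

¬T⇒≡false : ∀ {b} → ¬ T b → b ≡ false
¬T⇒≡false {false} _ = refl
¬T⇒≡false {true} ¬t = contradiction _ ¬t

≡⇒≡ᵇ≡true : ∀ {m n} → m ≡ n → (m ≡ᵇ n) ≡ true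
≡⇒≡ᵇ≡true {m} {n} m≡n = T⇒≡true (ℕₚ.≡⇒≡ᵇ m n m≡n)

≢⇒≡ᵇ≡false : ∀ {m n} → m ≢ n → (m ≡ᵇ n) ≡ false
≢⇒≡ᵇ≡false {m} {n} m≢n = ¬T⇒≡false (m≢n ∘ ℕₚ.≡ᵇ⇒≡ m n)

≡ᵇ-refl : ∀ n → (n ≡ᵇ n) ≡ true
≡ᵇ-refl n = ≡⇒≡ᵇ≡true (refl {x = n})

<⇒≡ᵇ≡false : ∀ {m n} → m < n → (m ≡ᵇ n) ≡ false
<⇒≡ᵇ≡false m<n = ≢⇒≡ᵇ≡false (ℕₚ.<⇒≢ m<n)

>⇒≡ᵇ≡false : ∀ {m n} → n < m → (m ≡ᵇ n) ≡ false
>⇒≡ᵇ≡false n<m = ≢⇒≡ᵇ≡false (ℕₚ.>⇒≢ n<m)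

≤⇒≤ᵇ≡true : ∀ {m n} → m ≤ n → (m ≤ᵇ n) ≡ true
≤⇒≤ᵇ≡true m≤n = T⇒≡true (ℕₚ.≤⇒≤ᵇ m≤n)

>⇒≤ᵇ≡false : ∀ {m n} → n < m → (m ≤ᵇ n) ≡ false
>⇒≤ᵇ≡false {m} {n} n<m = ¬T⇒≡false (ℕₚ.<⇒≱ n<m ∘ ℕₚ.≤ᵇ⇒≤ m n)

<⇒<ᵇ≡true : ∀ {m n} → m < n → (m <ᵇ n) ≡ true
<⇒<ᵇ≡true m<n = T⇒≡true (ℕₚ.<⇒<ᵇ m<n)

≥⇒<ᵇ≡false : ∀ {m n} → n ≤ m → (m <ᵇ n) ≡ false
≥⇒<ᵇ≡false {m} {n} n≤m = ¬T⇒≡false (ℕₚ.≤⇒≯ n≤m ∘ ℕₚ.<ᵇ⇒< m n)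

if-true : ∀ {A : Set} {b} {x y : A} → b ≡ true → (if b then x else y) ≡ x
if-true refl = refl

if-false : ∀ {A : Set} {b} {x y : A} → b ≡ false → (if b then x else y) ≡ y
if-false refl = refl

∧-true : ∀ {x y} → x ≡ true → y ≡ true → (x ∧ y) ≡ true
∧-true refl refl = refl

∧-falseˡ : ∀ {x} y → x ≡ false → (x ∧ y) ≡ false
∧-falseˡ _ refl = refl

∧-falseʳ : ∀ x {y} → y ≡ false → (x ∧ y) ≡ false
∧-falseʳ x refl = ∧-zeroʳ x

∨-trueˡ : ∀ {x} y → x ≡ true → (x ∨ y) ≡ true
∨-trueˡ _ refl = refl

∨-trueʳ : ∀ x {y} → y ≡ true → (x ∨ y) ≡ true
∨-trueʳ x refl = ∨-zeroʳ x

∨-false : ∀ {x y} → x ≡ false → y ≡ false → (x ∨ y) ≡ false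
∨-false refl refl = refl

ℚ-ring : AlmostCommutativeRing _ _
ℚ-ring = fromCommutativeRing +-*-commutativeRing (λ x → dec⇒maybe (0ℚ ℚₚ.≟ x))

ι≡mkℚ : ∀ n → ι n ≡ mkℚ (ℤ.+ n) 0 (coprime-sym (1-coprimeTo n))
ι≡mkℚ n = ℚₚ.normalize-coprime (coprime-sym (1-coprimeTo n))

ι-+ : ∀ a b → ι (a ℕ.+ b) ≡ ι a + ι b
ι-+ a b = ℚₚ.toℚᵘ-injective (ℚᵘₚ.≃-trans sum≃ (ℚᵘₚ.≃-sym (ℚₚ.toℚᵘ-homo-+ (ι a) (ι b))))
  where
  sum≃ : toℚᵘ (ι (a ℕ.+ b)) ℚᵘ.≃ toℚᵘ (ι a) ℚᵘ.+ toℚᵘ (ι b)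
  sum≃ rewrite ι≡mkℚ a | ι≡mkℚ b | ι≡mkℚ (a ℕ.+ b) =
    *≡* (sym (trans (ℤₚ.*-identityʳ _) (trans (cong₂ ℤ._+_ (ℤₚ.*-identityʳ (ℤ.+ a)) (ℤₚ.*-identityʳ (ℤ.+ b))) (sym (ℤₚ.*-identityʳ (ℤ.+ (a ℕ.+ b)))))))

ι-suc : ∀ n → ι (suc n) ≡ 1ℚ + ι n
ι-suc = ι-+ 1

ι-double : ∀ n → ι (2 ℕ.* n) ≡ ι 2 * ι n
ι-double n = begin
  ι (n ℕ.+ (n ℕ.+ 0))     ≡⟨ ι-+ n (n ℕ.+ 0) ⟩
  ι n + ι (n ℕ.+ 0)       ≡⟨ cong (λ t → ι n + ι t) (ℕₚ.+-identityʳ n) ⟩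
  ι n + ι n               ≡⟨ alg (ι n) ⟩
  ι 2 * ι n               ∎
  where
  alg : ∀ y → y + y ≡ ι 2 * y
  alg = solve-∀ ℚ-ring

1/n*ι[n]≡1 : ∀ n .{{_ : ℕ.NonZero n}} → (ℤ.+ 1 / n) * ι n ≡ 1ℚ
1/n*ι[n]≡1 (suc k) = begin
  (ℤ.+ 1 / suc k) * ι (suc k)      ≡⟨ cong₂ _*_ (ℚₚ.normalize-coprime (1-coprimeTo (suc k))) (ι≡mkℚ (suc k)) ⟩
  1/ q * q                       ≡⟨ ℚₚ.*-inverseˡ q ⟩
  1ℚ                             ∎
  where q = mkℚ (ℤ.+ suc k) 0 (coprime-sym (1-coprimeTo (suc k)))

*-cancelʳ : ∀ {x y} w .{{_ : NonZero w}} → x * w ≡ y * w → x ≡ y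
*-cancelʳ {x} {y} w xw≡yw = begin
  x                  ≡⟨ sym (ℚₚ.*-identityʳ x) ⟩
  x * 1ℚ             ≡⟨ cong (x *_) (sym (ℚₚ.*-inverseʳ w)) ⟩
  x * (w * 1/ w)     ≡⟨ sym (ℚₚ.*-assoc x w (1/ w)) ⟩
  x * w * 1/ w       ≡⟨ cong (_* 1/ w) xw≡yw ⟩
  y * w * 1/ w       ≡⟨ ℚₚ.*-assoc y w (1/ w) ⟩
  y * (w * 1/ w)     ≡⟨ cong (y *_) (ℚₚ.*-inverseʳ w) ⟩
  y * 1ℚ             ≡⟨ ℚₚ.*-identityʳ y ⟩
  y                  ∎

-- Lucas numbers

Lq-rec : ∀ n → Lq (suc (suc n)) ≡ Lq (suc n) + Lq n
Lq-rec n = ι-+ (Lucas (suc n)) (Lucas n)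

Lq-rec² : ∀ n → Lq (suc (suc (suc (suc n)))) ≡ ι 3 * Lq (suc (suc n)) - Lq n
Lq-rec² n = begin
  Lq (suc (suc (suc (suc n))))                  ≡⟨ Lq-rec (suc (suc n)) ⟩
  Lq (suc (suc (suc n))) + Lq (suc (suc n))     ≡⟨ cong (_+ Lq (suc (suc n))) (Lq-rec (suc n)) ⟩
  Lq (suc (suc n)) + Lq (suc n) + Lq (suc (suc n)) ≡⟨ cong (λ t → t + Lq (suc n) + t) (Lq-rec n) ⟩
  (Lq (suc n) + Lq n) + Lq (suc n) + (Lq (suc n) + Lq n) ≡⟨ alg (Lq n) (Lq (suc n)) ⟩
  ι 3 * (Lq (suc n) + Lq n) - Lq n              ≡⟨ cong (λ t → ι 3 * t - Lq n) (sym (Lq-rec n)) ⟩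
  ι 3 * Lq (suc (suc n)) - Lq n                 ∎
  where
  alg : ∀ l₀ l₁ → (l₁ + l₀) + l₁ + (l₁ + l₀) ≡ ι 3 * (l₁ + l₀) - l₀
  alg = solve-∀ ℚ-ring

Lucas-den : ∀ j → Lq (suc (suc j)) * ι 3 - Lq j * ι 2 ≡ ι (den (suc (suc j)))
Lucas-den j = begin
  Lq (suc (suc j)) * ι 3 - Lq j * ι 2              ≡⟨ cong (λ t → t * ι 3 - Lq j * ι 2) (Lq-rec j) ⟩
  (Lq (suc j) + Lq j) * ι 3 - Lq j * ι 2           ≡⟨ alg (Lq j) (Lq (suc j)) ⟩
  Lq (suc j) + ((Lq (suc j) + Lq j) + Lq (suc j))  ≡⟨ cong (λ t → Lq (suc j) + (t + Lq (suc j))) (sym (Lq-rec j)) ⟩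
  Lq (suc j) + (Lq (suc (suc j)) + Lq (suc j))     ≡⟨ cong (λ t → Lq (suc j) + t) (sym (Lq-rec (suc j))) ⟩
  Lq (suc j) + Lq (suc (suc (suc j)))              ≡⟨ sym (ι-+ (Lucas (suc j)) _) ⟩
  ι (den (suc (suc j)))                            ∎
  where
  alg : ∀ l₀ l₁ → (l₁ + l₀) * ι 3 - l₀ * ι 2 ≡ l₁ + ((l₁ + l₀) + l₁)
  alg = solve-∀ ℚ-ring

B : ℕ → ℚ
B k = Lq (2 ℕ.* k)

A : ℕ → ℕ → ℚ
A m k = Lq (2 ℕ.* m ∸ 2 ℕ.* k)

D : ℕ → ℚ
D m = ι (den (2 ℕ.* m))

Recurrence : (ℕ → ℚ) → ℕ → Set
Recurrence u k = u (suc (suc k)) ≡ ι 3 * u (suc k) - u k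

B-recurrence : ∀ k → Recurrence B k
B-recurrence k = begin
  B (suc (suc k))                    ≡⟨ cong Lq (trans (ℕₚ.*-suc 2 (suc k)) (cong (λ t → suc (suc t)) (ℕₚ.*-suc 2 k))) ⟩
  Lq (suc (suc (suc (suc (2 ℕ.* k))))) ≡⟨ Lq-rec² (2 ℕ.* k) ⟩
  ι 3 * Lq (suc (suc (2 ℕ.* k))) - B k ≡⟨ cong (λ t → ι 3 * Lq t - B k) (sym (ℕₚ.*-suc 2 k)) ⟩
  ι 3 * B (suc k) - B k              ∎

A≡B : ∀ m k → A m k ≡ B (m ∸ k)
A≡B m k = cong Lq (sym (ℕₚ.*-distribˡ-∸ 2 m k))

∸-suc : ∀ {m k} → k < m → m ∸ k ≡ suc (m ∸ suc k)
∸-suc {suc m} {zero} _ = refl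
∸-suc {suc m} {suc k} (s≤s k<m) = ∸-suc k<m

A-recurrence : ∀ {m k} → suc (suc k) ≤ m → Recurrence (A m) k
A-recurrence {m} {k} k+2≤m = begin
  A m (suc (suc k))                      ≡⟨ A≡B m (suc (suc k)) ⟩
  B s                                    ≡⟨ backwards (B s) (B (suc s)) (B (suc (suc s))) (B-recurrence s) ⟩
  ι 3 * B (suc s) - B (suc (suc s))      ≡⟨ sym (cong₂ (λ u v → ι 3 * u - v) (trans (A≡B m (suc k)) (cong B m∸[1+k]))
                                                                            (trans (A≡B m k) (cong B m∸k))) ⟩
  ι 3 * A m (suc k) - A m k              ∎
  where
  s = m ∸ suc (suc k)
  m∸[1+k] : m ∸ suc k ≡ suc s
  m∸[1+k] = ∸-suc k+2≤m
  m∸k : m ∸ k ≡ suc (suc s)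
  m∸k = trans (∸-suc (ℕₚ.<-trans (ℕₚ.n<1+n k) k+2≤m)) (cong suc m∸[1+k])
  backwards : ∀ u₀ u₁ u₂ → u₂ ≡ ι 3 * u₁ - u₀ → u₀ ≡ ι 3 * u₁ - u₂
  backwards u₀ u₁ _ refl = alg u₀ u₁
    where
    alg : ∀ u₀ u₁ → u₀ ≡ ι 3 * u₁ - (ι 3 * u₁ - u₀)
    alg = solve-∀ ℚ-ring

A-at-m : ∀ m → A m m ≡ ι 2
A-at-m m = cong Lq (ℕₚ.n∸n≡0 (2 ℕ.* m))

A-at-pred : ∀ p → A (suc p) p ≡ ι 3
A-at-pred p = trans (A≡B (suc p) p) (cong B (ℕₚ.m+n∸n≡m 1 p))

Casoratian : (ℕ → ℚ) → (ℕ → ℚ) → ℕ → ℚ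
Casoratian u v k = u k * v (suc k) - u (suc k) * v k

Casoratian-suc : ∀ {u v k} → Recurrence u k → Recurrence v k → Casoratian u v (suc k) ≡ Casoratian u v k
Casoratian-suc {u} {v} {k} u-rec v-rec = begin
  u (suc k) * v (suc (suc k)) - u (suc (suc k)) * v (suc k)
    ≡⟨ cong₂ (λ s t → u (suc k) * s - t * v (suc k)) v-rec u-rec ⟩
  u (suc k) * (ι 3 * v (suc k) - v k) - (ι 3 * u (suc k) - u k) * v (suc k)
    ≡⟨ alg (u k) (u (suc k)) (v k) (v (suc k)) ⟩
  u k * v (suc k) - u (suc k) * v k ∎
  where
  alg : ∀ u₀ u₁ v₀ v₁ → u₁ * (ι 3 * v₁ - v₀) - (ι 3 * u₁ - u₀) * v₁ ≡ u₀ * v₁ - u₁ * v₀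
  alg = solve-∀ ℚ-ring

Casoratian-A-B : ∀ p {k} → k ≤ p → Casoratian (A (suc p)) B k ≡ D (suc p)
Casoratian-A-B p {zero} _ = begin
  Lq (2 ℕ.* suc p) * ι 3 - Lq (2 ℕ.* suc p ∸ 2) * ι 2  ≡⟨ cong (λ t → Lq t * ι 3 - Lq (t ∸ 2) * ι 2) (ℕₚ.*-suc 2 p) ⟩
  Lq (suc (suc (2 ℕ.* p))) * ι 3 - Lq (2 ℕ.* p) * ι 2  ≡⟨ Lucas-den (2 ℕ.* p) ⟩
  ι (den (suc (suc (2 ℕ.* p))))                        ≡⟨ cong (λ t → ι (den t)) (sym (ℕₚ.*-suc 2 p)) ⟩
  D (suc p)                                            ∎
Casoratian-A-B p {suc k} k<p = trans (Casoratian-suc {A (suc p)} {B} {k} (A-recurrence (s≤s k<p)) (B-recurrence k)) (Casoratian-A-B p (ℕₚ.<⇒≤ k<p))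

∑ : ℕ → (ℕ → ℚ) → ℚ
∑ n f = Σ n (λ k → f (toℕ k))

Σ-cong : ∀ {n} {f g : Fin n → ℚ} → (∀ k → f k ≡ g k) → Σ n f ≡ Σ n g
Σ-cong {zero} _ = refl
Σ-cong {suc n} f≗g = cong₂ _+_ (f≗g zero) (Σ-cong (λ k → f≗g (suc k)))

Σ-*ˡ : ∀ {n} c (f : Fin n → ℚ) → Σ n (λ k → c * f k) ≡ c * Σ n f
Σ-*ˡ {zero} c f = sym (ℚₚ.*-zeroʳ c)
Σ-*ˡ {suc n} c f = trans (cong (c * f zero +_) (Σ-*ˡ c (λ k → f (suc k)))) (sym (ℚₚ.*-distribˡ-+ c (f zero) _))

∑-cong : ∀ {n f g} → (∀ k → k < n → f k ≡ g k) → ∑ n f ≡ ∑ n g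
∑-cong f≗g = Σ-cong (λ k → f≗g (toℕ k) (toℕ<n k))

∑-zero : ∀ {n f} → (∀ k → k < n → f k ≡ 0ℚ) → ∑ n f ≡ 0ℚ
∑-zero {zero} _ = refl
∑-zero {suc n} f≗0 = trans (cong₂ _+_ (f≗0 0 (s≤s z≤n)) (∑-zero (λ k k<n → f≗0 (suc k) (s≤s k<n)))) (ℚₚ.+-identityˡ 0ℚ)

∑-snoc : ∀ n f → ∑ (suc n) f ≡ ∑ n f + f n
∑-snoc zero f = trans (ℚₚ.+-identityʳ (f 0)) (sym (ℚₚ.+-identityˡ (f 0)))
∑-snoc (suc n) f = trans (cong (f 0 +_) (∑-snoc n (λ k → f (suc k)))) (sym (ℚₚ.+-assoc (f 0) _ _))

erase : ℕ → (ℕ → ℚ) → ℕ → ℚ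
erase p f k = if k ≡ᵇ p then 0ℚ else f k

∑-erase : ∀ {n p} f → p < n → ∑ n f ≡ f p + ∑ n (erase p f)
∑-erase {suc n} {zero} f _ = cong (f 0 +_) (sym (ℚₚ.+-identityˡ _))
∑-erase {suc n} {suc p} f (s≤s p<n) = begin
  f 0 + ∑ n (λ k → f (suc k))                                    ≡⟨ cong (f 0 +_) (∑-erase (λ k → f (suc k)) p<n) ⟩
  f 0 + (f (suc p) + ∑ n (erase p (λ k → f (suc k))))            ≡⟨ swap (f 0) (f (suc p)) _ ⟩
  f (suc p) + (f 0 + ∑ n (erase p (λ k → f (suc k))))            ∎
  where
  swap : ∀ x y z → x + (y + z) ≡ y + (x + z)
  swap = solve-∀ ℚ-ring

∑-support : ∀ {n} f ps → Unique ps → All (_< n) ps → (∀ k → k < n → All (k ≢_) ps → f k ≡ 0ℚ) →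
            ∑ n f ≡ foldr (λ p s → f p + s) 0ℚ ps
∑-support f [] _ _ f-vanishes = ∑-zero (λ k k<n → f-vanishes k k<n [])
∑-support {n} f (p ∷ ps) (p∉ps ∷ ps-unique) (p<n ∷ ps<n) f-vanishes = begin
  ∑ n f                                           ≡⟨ ∑-erase f p<n ⟩
  f p + ∑ n (erase p f)                           ≡⟨ cong (f p +_) (∑-support (erase p f) ps ps-unique ps<n erased-vanishes) ⟩
  f p + foldr (λ q s → erase p f q + s) 0ℚ ps     ≡⟨ cong (f p +_) (erase-off p∉ps) ⟩
  f p + foldr (λ q s → f q + s) 0ℚ ps             ∎
  where
  erased-vanishes : ∀ k → k < n → All (k ≢_) ps → erase p f k ≡ 0ℚ
  erased-vanishes k k<n k∉ps with k ℕₚ.≟ p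
  ... | yes k≡p = if-true (≡⇒≡ᵇ≡true k≡p)
  ... | no k≢p = trans (if-false (≢⇒≡ᵇ≡false k≢p)) (f-vanishes k k<n (k≢p ∷ k∉ps))
  erase-off : ∀ {qs} → All (p ≢_) qs → foldr (λ q s → erase p f q + s) 0ℚ qs ≡ foldr (λ q s → f q + s) 0ℚ qs
  erase-off [] = refl
  erase-off {q ∷ _} (p≢q ∷ p∉qs) = cong₂ _+_ (if-false (≢⇒≡ᵇ≡false (p≢q ∘ sym))) (erase-off p∉qs)

increasing⇒unique : ∀ {ps} → Linked _<_ ps → Unique ps
increasing⇒unique = AllPairs.map ℕₚ.<⇒≢ ∘ Linked⇒AllPairs ℕₚ.<-trans

δ : ℕ → ℕ → ℚ
δ i j = if i ≡ᵇ j then 1ℚ else 0ℚ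

δ-refl : ∀ i → δ i i ≡ 1ℚ
δ-refl i = if-true (≡ᵇ-refl i)

δ-≢ : ∀ {i j} → i ≢ j → δ i j ≡ 0ℚ
δ-≢ i≢j = if-false (≢⇒≡ᵇ≡false i≢j)

∑-δ-inside : ∀ {n j} → j < n → ∑ n (λ i → δ i j) ≡ 1ℚ
∑-δ-inside {n} {j} j<n = begin
  ∑ n (λ i → δ i j)         ≡⟨ ∑-support (λ i → δ i j) (j ∷ []) ([] ∷ []) (j<n ∷ []) (λ i _ → λ { (i≢j ∷ []) → δ-≢ i≢j }) ⟩
  δ j j + 0ℚ                ≡⟨ cong (_+ 0ℚ) (δ-refl j) ⟩
  1ℚ                        ∎

∑-δ-outside : ∀ {n j} → n ≤ j → ∑ n (λ i → δ i j) ≡ 0ℚ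
∑-δ-outside n≤j = ∑-zero (λ i i<n → δ-≢ (ℕₚ.<⇒≢ (ℕₚ.<-≤-trans i<n n≤j)))

Δ : (ℕ → ℚ) → ℕ → ℚ
Δ x a = ι 3 * x (suc a) - x a - x (suc (suc a))

Δ-values : ∀ x a {v₀ v₁ v₂} → x a ≡ v₀ → x (suc a) ≡ v₁ → x (suc (suc a)) ≡ v₂ → Δ x a ≡ ι 3 * v₁ - v₀ - v₂
Δ-values x a x₀ x₁ x₂ = cong₂ _-_ (cong₂ _-_ (cong (ι 3 *_) x₁) x₀) x₂

∑-Δ : ∀ n x c → ∑ n (λ a → Δ x a - c) ≡ ∑ n (λ a → x (suc a)) + x n + x 1 - x 0 - x (suc n) - ι n * c
∑-Δ zero x c = base (x 0) (x 1) c
  where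
  base : ∀ x₀ x₁ c → 0ℚ ≡ 0ℚ + x₀ + x₁ - x₀ - x₁ - ι 0 * c
  base = solve-∀ ℚ-ring
∑-Δ (suc n) x c = begin
  ∑ (suc n) (λ a → Δ x a - c)                       ≡⟨ ∑-snoc n (λ a → Δ x a - c) ⟩
  ∑ n (λ a → Δ x a - c) + (Δ x n - c)               ≡⟨ cong (_+ (Δ x n - c)) (∑-Δ n x c) ⟩
  S + x n + x 1 - x 0 - x (suc n) - ι n * c + (ι 3 * x (suc n) - x n - x (suc (suc n)) - c)
                                                    ≡⟨ step S (x n) (x 1) (x 0) (x (suc n)) (x (suc (suc n))) c (ι n) ⟩
  (S + x (suc n)) + x (suc n) + x 1 - x 0 - x (suc (suc n)) - (1ℚ + ι n) * c
                                                    ≡⟨ cong₂ (λ s t → s + x (suc n) + x 1 - x 0 - x (suc (suc n)) - t * c)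
                                                             (sym (∑-snoc n (λ a → x (suc a)))) (sym (ι-suc n)) ⟩
  ∑ (suc n) (λ a → x (suc a)) + x (suc n) + x 1 - x 0 - x (suc (suc n)) - ι (suc n) * c ∎
  where
  S = ∑ n (λ a → x (suc a))
  step : ∀ S xₙ x₁ x₀ xₙ₊₁ xₙ₊₂ c ιn →
         S + xₙ + x₁ - x₀ - xₙ₊₁ - ιn * c + (ι 3 * xₙ₊₁ - xₙ - xₙ₊₂ - c)
         ≡ (S + xₙ₊₁) + xₙ₊₁ + x₁ - x₀ - xₙ₊₂ - (1ℚ + ιn) * c
  step = solve-∀ ℚ-ring

data Index (m : ℕ) : ℕ → Set where
  inner  : ∀ {a} → suc a < m → Index m (suc a)
  middle : Index m m
  last   : Index m (suc m)

index : ∀ {m i} → 1 ≤ i → i ≤ suc m → Index m i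
index {m} {suc a} _ i≤1+m with ℕₚ.<-cmp (suc a) m
... | tri< i<m _ _ = inner i<m
... | tri≈ _ refl _ = middle
... | tri> _ _ m<i with ℕₚ.≤-antisym i≤1+m m<i
...   | refl = last

index-of : ∀ {m} (i : Fin (suc m)) → Index m (suc (toℕ i))
index-of i = index (s≤s z≤n) (toℕ<n i)

-- The rows of H

module _ {m a : ℕ} (1+a<m : suc a < m) where

  private
    1+a<1+m : suc a < suc m
    1+a<1+m = ℕₚ.<-trans 1+a<m (ℕₚ.n<1+n m)

  H-inner-pred : Hentry m (suc a) a ≡ - 1ℚ
  H-inner-pred =
    trans (if-false (∧-falseˡ (suc a ≤ᵇ m) (>⇒≡ᵇ≡false (ℕₚ.n<1+n a))))
    (trans (if-false (∧-falseˡ (a ≡ᵇ suc m) (<⇒≡ᵇ≡false 1+a<1+m)))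
    (trans (if-false (∧-falseˡ (a ≡ᵇ m ∸ 1) (<⇒≡ᵇ≡false 1+a<m)))
           (if-true (∨-trueʳ (suc (suc a) ≡ᵇ a) (≡ᵇ-refl (suc a))))))

  H-inner-diag : Hentry m (suc a) (suc a) ≡ ι 3
  H-inner-diag = if-true (∧-true (≡ᵇ-refl (suc a)) (≤⇒≤ᵇ≡true (ℕₚ.<⇒≤ 1+a<m)))

  H-inner-succ : Hentry m (suc a) (suc (suc a)) ≡ - 1ℚ
  H-inner-succ =
    trans (if-false (∧-falseˡ (suc a ≤ᵇ m) (<⇒≡ᵇ≡false (ℕₚ.n<1+n (suc a)))))
    (trans (if-false (∧-falseˡ (suc (suc a) ≡ᵇ suc m) (<⇒≡ᵇ≡false 1+a<1+m)))
    (trans (if-false (∧-falseˡ (suc (suc a) ≡ᵇ m ∸ 1) (<⇒≡ᵇ≡false 1+a<m)))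
           (if-true (∨-trueˡ (suc (suc (suc a)) ≡ᵇ suc a) (≡ᵇ-refl (suc (suc a)))))))

  H-inner-last : Hentry m (suc a) (suc m) ≡ - 1ℚ
  H-inner-last =
    trans (if-false (∧-falseˡ (suc a ≤ᵇ m) (<⇒≡ᵇ≡false 1+a<1+m)))
    (trans (if-false (∧-falseˡ (suc m ≡ᵇ suc m) (<⇒≡ᵇ≡false 1+a<1+m)))
    (trans (if-false (∧-falseˡ (suc m ≡ᵇ m ∸ 1) (<⇒≡ᵇ≡false 1+a<m)))
    (trans (if-false (∨-false (<⇒≡ᵇ≡false (s≤s 1+a<m)) (>⇒≡ᵇ≡false (ℕₚ.<-trans 1+a<1+m (ℕₚ.n<1+n (suc m))))))
           (if-true (∧-true (≡ᵇ-refl (suc m)) (≤⇒≤ᵇ≡true (ℕₚ.<⇒≤ 1+a<m)))))))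

  H-inner-zero : ∀ {k} → k ≢ a → k ≢ suc a → k ≢ suc (suc a) → k ≢ suc m → Hentry m (suc a) k ≡ 0ℚ
  H-inner-zero {k} k≢a k≢1+a k≢2+a k≢1+m =
    trans (if-false (∧-falseˡ (suc a ≤ᵇ m) (≢⇒≡ᵇ≡false (k≢1+a ∘ sym))))
    (trans (if-false (∧-falseˡ (k ≡ᵇ suc m) (<⇒≡ᵇ≡false 1+a<1+m)))
    (trans (if-false (∧-falseˡ (k ≡ᵇ m ∸ 1) (<⇒≡ᵇ≡false 1+a<m)))
    (trans (if-false (∨-false (≢⇒≡ᵇ≡false (k≢2+a ∘ sym)) (≢⇒≡ᵇ≡false k≢a)))
    (trans (if-false (∧-falseˡ ((1 ≤ᵇ suc a) ∧ (suc a ≤ᵇ m)) (≢⇒≡ᵇ≡false k≢1+m)))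
           (if-false (∧-falseˡ ((1 ≤ᵇ k) ∧ (k ≤ᵇ m ∸ 1)) (<⇒≡ᵇ≡false 1+a<1+m)))))))

module _ (p : ℕ) where

  private
    m = suc p

  H-middle-pred : Hentry m m p ≡ - ι 2
  H-middle-pred =
    trans (if-false (∧-falseˡ (m ≤ᵇ m) (>⇒≡ᵇ≡false (ℕₚ.n<1+n p))))
    (trans (if-false (∧-falseˡ (p ≡ᵇ suc m) (<⇒≡ᵇ≡false (ℕₚ.n<1+n m))))
           (if-true (∧-true (≡ᵇ-refl m) (≡ᵇ-refl p))))

  H-middle-diag : Hentry m m m ≡ ι 3
  H-middle-diag = if-true (∧-true (≡ᵇ-refl m) (≤⇒≤ᵇ≡true (ℕₚ.≤-refl {m})))

  H-middle-succ : Hentry m m (suc m) ≡ - 1ℚ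
  H-middle-succ =
    trans (if-false (∧-falseˡ (m ≤ᵇ m) (<⇒≡ᵇ≡false (ℕₚ.n<1+n m))))
    (trans (if-false (∧-falseˡ (suc m ≡ᵇ suc m) (<⇒≡ᵇ≡false (ℕₚ.n<1+n m))))
    (trans (if-false (∧-falseʳ (m ≡ᵇ m) (>⇒≡ᵇ≡false (ℕₚ.<-trans (ℕₚ.n<1+n p) (ℕₚ.n<1+n m)))))
           (if-true (∨-trueˡ (suc (suc m) ≡ᵇ m) (≡ᵇ-refl (suc m))))))

  H-middle-zero : ∀ {k} → k ≢ p → k ≢ m → k ≢ suc m → Hentry m m k ≡ 0ℚ
  H-middle-zero {k} k≢p k≢m k≢1+m =
    trans (if-false (∧-falseˡ (m ≤ᵇ m) (≢⇒≡ᵇ≡false (k≢m ∘ sym))))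
    (trans (if-false (∧-falseˡ (k ≡ᵇ suc m) (<⇒≡ᵇ≡false (ℕₚ.n<1+n m))))
    (trans (if-false (∧-falseʳ (m ≡ᵇ m) (≢⇒≡ᵇ≡false k≢p)))
    (trans (if-false (∨-false (≢⇒≡ᵇ≡false (k≢1+m ∘ sym)) (≢⇒≡ᵇ≡false k≢p)))
    (trans (if-false (∧-falseˡ ((1 ≤ᵇ m) ∧ (m ≤ᵇ m)) (≢⇒≡ᵇ≡false k≢1+m)))
           (if-false (∧-falseˡ ((1 ≤ᵇ k) ∧ (k ≤ᵇ p)) (<⇒≡ᵇ≡false (ℕₚ.n<1+n m))))))))

  H-last-zero : Hentry m (suc m) 0 ≡ 0ℚ
  H-last-zero =
    trans (if-false (∧-falseʳ (suc m ≡ᵇ suc m) refl))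
    (trans (if-false (∧-falseˡ (0 ≡ᵇ p) (>⇒≡ᵇ≡false (ℕₚ.n<1+n m))))
           (if-false (∧-falseʳ (suc m ≡ᵇ suc m) refl)))

  H-last-inner : ∀ {b} → suc b < m → Hentry m (suc m) (suc b) ≡ - ι 2
  H-last-inner {b} 1+b<m =
    trans (if-false (∧-falseˡ (suc m ≤ᵇ m) (>⇒≡ᵇ≡false 1+b<1+m)))
    (trans (if-false (∧-falseʳ (suc m ≡ᵇ suc m) (<⇒≡ᵇ≡false 1+b<1+m)))
    (trans (if-false (∧-falseˡ (suc b ≡ᵇ p) (>⇒≡ᵇ≡false (ℕₚ.n<1+n m))))
    (trans (if-false (∨-false (>⇒≡ᵇ≡false (ℕₚ.<-trans 1+b<1+m (ℕₚ.n<1+n (suc m)))) (<⇒≡ᵇ≡false (s≤s 1+b<m))))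
    (trans (if-false (∧-falseˡ ((1 ≤ᵇ suc m) ∧ (suc m ≤ᵇ m)) (<⇒≡ᵇ≡false 1+b<1+m)))
           (if-true (∧-true (≡ᵇ-refl (suc m)) (≤⇒≤ᵇ≡true (ℕₚ.≤-pred 1+b<m))))))))
    where
    1+b<1+m = ℕₚ.<-trans 1+b<m (ℕₚ.n<1+n m)

  H-last-middle : Hentry m (suc m) m ≡ - 1ℚ
  H-last-middle =
    trans (if-false (∧-falseˡ (suc m ≤ᵇ m) (>⇒≡ᵇ≡false (ℕₚ.n<1+n m))))
    (trans (if-false (∧-falseʳ (suc m ≡ᵇ suc m) (<⇒≡ᵇ≡false (ℕₚ.n<1+n m))))
    (trans (if-false (∧-falseˡ (m ≡ᵇ p) (>⇒≡ᵇ≡false (ℕₚ.n<1+n m))))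
           (if-true (∨-trueʳ (suc (suc m) ≡ᵇ m) (≡ᵇ-refl (suc m))))))

  H-last-last : Hentry m (suc m) (suc m) ≡ ι (2 ℕ.* m)
  H-last-last =
    trans (if-false (∧-falseʳ (suc m ≡ᵇ suc m) (>⇒≤ᵇ≡false (ℕₚ.n<1+n m))))
          (if-true (∧-true (≡ᵇ-refl (suc m)) (≡ᵇ-refl (suc m))))

-- The sum runs over positions 0 … m+1.  Position 0 lies outside the matrix, but
-- K vanishes there, and including it gives row 1 the shape of the other inner rows.

applyH : ℕ → (ℕ → ℚ) → ℕ → ℚ
applyH m x i = ∑ (suc (suc m)) (λ k → Hentry m i k * x k)

applyH-inner : ∀ {m a} x → suc a < m → applyH m x (suc a) ≡ Δ x a - x (suc m)
applyH-inner {m} {a} x 1+a<m = begin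
  applyH m x (suc a)                                      ≡⟨ ∑-support f (a ∷ suc a ∷ suc (suc a) ∷ suc m ∷ []) support-unique support-bounded f-vanishes ⟩
  f a + (f (suc a) + (f (suc (suc a)) + (f (suc m) + 0ℚ))) ≡⟨ collect (H-inner-pred 1+a<m) (H-inner-diag 1+a<m) (H-inner-succ 1+a<m) (H-inner-last 1+a<m) ⟩
  Δ x a - x (suc m)                                       ∎
  where
  f : ℕ → ℚ
  f k = Hentry m (suc a) k * x k
  support-unique : Unique (a ∷ suc a ∷ suc (suc a) ∷ suc m ∷ [])
  support-unique = increasing⇒unique (ℕₚ.n<1+n a ∷ ℕₚ.n<1+n (suc a) ∷ s≤s 1+a<m ∷ [-])
  support-bounded : All (_< suc (suc m)) (a ∷ suc a ∷ suc (suc a) ∷ suc m ∷ [])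
  support-bounded = ℕₚ.m<n⇒m<1+n (ℕₚ.<-trans (ℕₚ.n<1+n a) (ℕₚ.m<n⇒m<1+n 1+a<m)) ∷ ℕₚ.m<n⇒m<1+n (ℕₚ.m<n⇒m<1+n 1+a<m)
                  ∷ s≤s (ℕₚ.m<n⇒m<1+n 1+a<m) ∷ ℕₚ.n<1+n (suc m) ∷ []
  f-vanishes : ∀ k → k < suc (suc m) → All (k ≢_) (a ∷ suc a ∷ suc (suc a) ∷ suc m ∷ []) → f k ≡ 0ℚ
  f-vanishes k _ (k≢a ∷ k≢1+a ∷ k≢2+a ∷ k≢1+m ∷ []) =
    trans (cong (_* x k) (H-inner-zero 1+a<m k≢a k≢1+a k≢2+a k≢1+m)) (ℚₚ.*-zeroˡ (x k))
  collect : ∀ {h₀ h₁ h₂ h₃} → h₀ ≡ - 1ℚ → h₁ ≡ ι 3 → h₂ ≡ - 1ℚ → h₃ ≡ - 1ℚ →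
            h₀ * x a + (h₁ * x (suc a) + (h₂ * x (suc (suc a)) + (h₃ * x (suc m) + 0ℚ))) ≡ Δ x a - x (suc m)
  collect refl refl refl refl = alg (x a) (x (suc a)) (x (suc (suc a))) (x (suc m))
    where
    alg : ∀ x₀ x₁ x₂ x₃ → - 1ℚ * x₀ + (ι 3 * x₁ + (- 1ℚ * x₂ + (- 1ℚ * x₃ + 0ℚ))) ≡ ι 3 * x₁ - x₀ - x₂ - x₃
    alg = solve-∀ ℚ-ring

applyH-middle : ∀ p x → applyH (suc p) x (suc p) ≡ ι 3 * x (suc p) - ι 2 * x p - x (suc (suc p))
applyH-middle p x = begin
  applyH m x m                                            ≡⟨ ∑-support f (p ∷ m ∷ suc m ∷ []) support-unique support-bounded f-vanishes ⟩
  f p + (f m + (f (suc m) + 0ℚ))                          ≡⟨ collect (H-middle-pred p) (H-middle-diag p) (H-middle-succ p) ⟩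
  ι 3 * x m - ι 2 * x p - x (suc m)                       ∎
  where
  m = suc p
  f : ℕ → ℚ
  f k = Hentry m m k * x k
  support-unique : Unique (p ∷ m ∷ suc m ∷ [])
  support-unique = increasing⇒unique (ℕₚ.n<1+n p ∷ ℕₚ.n<1+n m ∷ [-])
  support-bounded : All (_< suc (suc m)) (p ∷ m ∷ suc m ∷ [])
  support-bounded = ℕₚ.m<n⇒m<1+n (ℕₚ.m<n⇒m<1+n (ℕₚ.n<1+n p)) ∷ ℕₚ.m<n⇒m<1+n (ℕₚ.n<1+n m) ∷ ℕₚ.n<1+n (suc m) ∷ []
  f-vanishes : ∀ k → k < suc (suc m) → All (k ≢_) (p ∷ m ∷ suc m ∷ []) → f k ≡ 0ℚ
  f-vanishes k _ (k≢p ∷ k≢m ∷ k≢1+m ∷ []) = trans (cong (_* x k) (H-middle-zero p k≢p k≢m k≢1+m)) (ℚₚ.*-zeroˡ (x k))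
  collect : ∀ {h₀ h₁ h₂} → h₀ ≡ - ι 2 → h₁ ≡ ι 3 → h₂ ≡ - 1ℚ →
            h₀ * x p + (h₁ * x m + (h₂ * x (suc m) + 0ℚ)) ≡ ι 3 * x m - ι 2 * x p - x (suc m)
  collect refl refl refl = alg (x p) (x m) (x (suc m))
    where
    alg : ∀ x₀ x₁ x₂ → - ι 2 * x₀ + (ι 3 * x₁ + (- 1ℚ * x₂ + 0ℚ)) ≡ ι 3 * x₁ - ι 2 * x₀ - x₂
    alg = solve-∀ ℚ-ring

applyH-last : ∀ p x → applyH (suc p) x (suc (suc p)) ≡ - ι 2 * ∑ p (λ a → x (suc a)) - x (suc p) + ι (2 ℕ.* suc p) * x (suc (suc p))
applyH-last p x = begin
  applyH m x (suc m)                                      ≡⟨ ∑-snoc (suc m) f ⟩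
  ∑ (suc m) f + f (suc m)                                 ≡⟨ cong (_+ f (suc m)) (∑-snoc m f) ⟩
  f 0 + ∑ p (λ a → f (suc a)) + f m + f (suc m)           ≡⟨ cong (λ t → f 0 + t + f m + f (suc m)) inner-part ⟩
  f 0 + - ι 2 * S + f m + f (suc m)                       ≡⟨ collect (H-last-zero p) (H-last-middle p) (H-last-last p) ⟩
  - ι 2 * S - x m + ι (2 ℕ.* m) * x (suc m)               ∎
  where
  m = suc p
  f : ℕ → ℚ
  f k = Hentry m (suc m) k * x k
  S = ∑ p (λ a → x (suc a))
  inner-part : ∑ p (λ a → f (suc a)) ≡ - ι 2 * S
  inner-part = trans (∑-cong (λ a a<p → cong (_* x (suc a)) (H-last-inner p (s≤s a<p)))) (Σ-*ˡ {p} (- ι 2) (λ a → x (suc (toℕ a))))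
  collect : ∀ {h₀ h₁ h₂} → h₀ ≡ 0ℚ → h₁ ≡ - 1ℚ → h₂ ≡ ι (2 ℕ.* m) →
            h₀ * x 0 + - ι 2 * S + h₁ * x m + h₂ * x (suc m) ≡ - ι 2 * S - x m + ι (2 ℕ.* m) * x (suc m)
  collect refl refl refl = alg (x 0) S (x m) (x (suc m)) (ι (2 ℕ.* m))
    where
    alg : ∀ x₀ S xₘ xₘ₊₁ c → 0ℚ * x₀ + - ι 2 * S + - 1ℚ * xₘ + c * xₘ₊₁ ≡ - ι 2 * S - xₘ + c * xₘ₊₁
    alg = solve-∀ ℚ-ring

applyH-weighted-rows : ∀ p x →
  applyH (suc p) x (suc (suc p)) + ι 2 * ∑ p (λ a → applyH (suc p) x (suc a)) + applyH (suc p) x (suc p)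
  ≡ ι 2 * x 1 + x (suc (suc p)) - ι 2 * x 0
applyH-weighted-rows p x =
  collect (trans (ι-double (suc p)) (cong (ι 2 *_) (ι-suc p))) (applyH-last p x) inner-rows (applyH-middle p x)
  where
  m = suc p
  S = ∑ p (λ a → x (suc a))
  inner-rows : ∑ p (λ a → applyH m x (suc a)) ≡ S + x p + x 1 - x 0 - x m - ι p * x (suc m)
  inner-rows = trans (∑-cong (λ a a<p → applyH-inner {m} {a} x (s≤s a<p))) (∑-Δ p x (x (suc m)))
  collect : ∀ {c r₁ r₂ r₃} → c ≡ ι 2 * (1ℚ + ι p) →
            r₁ ≡ - ι 2 * S - x m + c * x (suc m) →
            r₂ ≡ S + x p + x 1 - x 0 - x m - ι p * x (suc m) →
            r₃ ≡ ι 3 * x m - ι 2 * x p - x (suc m) →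
            r₁ + ι 2 * r₂ + r₃ ≡ ι 2 * x 1 + x (suc m) - ι 2 * x 0
  collect refl refl refl refl = alg S (x 0) (x 1) (x p) (x m) (x (suc m)) (ι p)
    where
    alg : ∀ S x₀ x₁ xₚ xₘ xₘ₊₁ ιp →
          - ι 2 * S - xₘ + ι 2 * (1ℚ + ιp) * xₘ₊₁ + ι 2 * (S + xₚ + x₁ - x₀ - xₘ - ιp * xₘ₊₁) + (ι 3 * xₘ - ι 2 * xₚ - xₘ₊₁)
          ≡ ι 2 * x₁ + xₘ₊₁ - ι 2 * x₀
    alg = solve-∀ ℚ-ring

-- The columns of K

module _ (p : ℕ) where

  private
    m = suc p

  K-zero-row : ∀ j → Kentry m 0 j ≡ 0ℚ
  K-zero-row j = trans (if-false (∧-zeroʳ (1 ≤ᵇ j))) (trans (if-false (∧-zeroʳ (j ≡ᵇ m))) (if-false (∧-zeroʳ (j ≡ᵇ suc m))))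

  K-upper : ∀ {a b} → a ≤ b → suc b ≤ p →
            Kentry m (suc a) (suc b) ≡ ι 2 * (B m - A m (suc a)) + A m (suc b) * (B (suc a) - ι 2)
  K-upper a≤b 1+b≤p = if-true (∧-true (≤⇒≤ᵇ≡true (s≤s a≤b)) (≤⇒≤ᵇ≡true 1+b≤p))

  K-lower : ∀ {a b} → b < a → suc a ≤ m →
            Kentry m (suc a) (suc b) ≡ ι 2 * (B m - A m (suc b)) + A m (suc a) * (B (suc b) - ι 2)
  K-lower {b = b} b<a 1+a≤m =
    trans (if-false (∧-falseˡ (suc b ≤ᵇ p) (>⇒≤ᵇ≡false (s≤s b<a))))
          (if-true (∧-true (<⇒<ᵇ≡true (s≤s b<a)) (≤⇒≤ᵇ≡true 1+a≤m)))

  K-middle-col : ∀ {a} → suc a ≤ m → Kentry m (suc a) m ≡ B m - A m (suc a) + B (suc a) - ι 2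
  K-middle-col {a} 1+a≤m =
    trans (if-false (∧-falseʳ (suc a ≤ᵇ m) (>⇒≤ᵇ≡false (ℕₚ.n<1+n p))))
    (trans (if-false (∧-falseˡ (suc a ≤ᵇ m) (≥⇒<ᵇ≡false 1+a≤m)))
           (if-true (∧-true (≡ᵇ-refl m) (≤⇒≤ᵇ≡true 1+a≤m))))

  K-last-col : ∀ {a} → suc a ≤ m → Kentry m (suc a) (suc m) ≡ B m - A m (suc a)
  K-last-col {a} 1+a≤m =
    trans (if-false (∧-falseʳ (suc a ≤ᵇ suc m) (>⇒≤ᵇ≡false (ℕₚ.<-trans (ℕₚ.n<1+n p) (ℕₚ.n<1+n m)))))
    (trans (if-false (∧-falseˡ (suc a ≤ᵇ m) (≥⇒<ᵇ≡false (ℕₚ.m≤n⇒m≤1+n 1+a≤m))))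
    (trans (if-false (∧-falseˡ ((1 ≤ᵇ suc a) ∧ (suc a ≤ᵇ m)) (>⇒≡ᵇ≡false (ℕₚ.n<1+n m))))
    (trans (if-false (∧-falseˡ ((1 ≤ᵇ suc m) ∧ (suc m ≤ᵇ p)) (<⇒≡ᵇ≡false (s≤s 1+a≤m))))
    (trans (if-false (∧-falseˡ (suc m ≡ᵇ m) (<⇒≡ᵇ≡false (s≤s 1+a≤m))))
           (if-true (∧-true (≡ᵇ-refl (suc m)) (≤⇒≤ᵇ≡true 1+a≤m)))))))

  K-last-inner : ∀ {b} → suc b ≤ p → Kentry m (suc m) (suc b) ≡ ι 2 * (B m - A m (suc b))
  K-last-inner {b} 1+b≤p =
    trans (if-false (∧-falseˡ (suc b ≤ᵇ p) (>⇒≤ᵇ≡false (s≤s (ℕₚ.m<n⇒m<1+n 1+b≤p)))))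
    (trans (if-false (∧-falseʳ (suc b <ᵇ suc m) (>⇒≤ᵇ≡false (ℕₚ.n<1+n m))))
    (trans (if-false (∧-falseˡ ((1 ≤ᵇ suc m) ∧ (suc m ≤ᵇ m)) (<⇒≡ᵇ≡false (s≤s 1+b≤p))))
           (if-true (∧-true (≡ᵇ-refl (suc m)) (≤⇒≤ᵇ≡true 1+b≤p)))))

  K-last-middle : Kentry m (suc m) m ≡ B m - ι 2
  K-last-middle =
    trans (if-false (∧-falseˡ (m ≤ᵇ p) (>⇒≤ᵇ≡false (ℕₚ.n<1+n m))))
    (trans (if-false (∧-falseʳ (m <ᵇ suc m) (>⇒≤ᵇ≡false (ℕₚ.n<1+n m))))
    (trans (if-false (∧-falseʳ (m ≡ᵇ m) (>⇒≤ᵇ≡false (ℕₚ.n<1+n m))))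
    (trans (if-false (∧-falseʳ (suc m ≡ᵇ suc m) (>⇒≤ᵇ≡false (ℕₚ.n<1+n p))))
           (if-true (∧-true (≡ᵇ-refl (suc m)) (≡ᵇ-refl m))))))

  K-last-last : Kentry m (suc m) (suc m) ≡ B m
  K-last-last =
    trans (if-false (∧-falseʳ (suc m ≤ᵇ suc m) (>⇒≤ᵇ≡false (ℕₚ.<-trans (ℕₚ.n<1+n p) (ℕₚ.n<1+n m)))))
    (trans (if-false (∧-falseˡ (suc m ≤ᵇ m) (≥⇒<ᵇ≡false (ℕₚ.≤-refl {suc m}))))
    (trans (if-false (∧-falseˡ ((1 ≤ᵇ suc m) ∧ (suc m ≤ᵇ m)) (>⇒≡ᵇ≡false (ℕₚ.n<1+n m))))
    (trans (if-false (∧-falseʳ (suc m ≡ᵇ suc m) (>⇒≤ᵇ≡false (ℕₚ.<-trans (ℕₚ.n<1+n p) (ℕₚ.n<1+n m)))))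
    (trans (if-false (∧-falseʳ (suc m ≡ᵇ suc m) (>⇒≡ᵇ≡false (ℕₚ.n<1+n m))))
    (trans (if-false (∧-falseʳ (suc m ≡ᵇ suc m) (>⇒≤ᵇ≡false (ℕₚ.n<1+n m))))
           (if-true (∧-true (≡ᵇ-refl (suc m)) (≡ᵇ-refl (suc m)))))))))

affine : ℕ → ℚ → ℚ → ℚ → ℕ → ℚ
affine m c α β k = c + α * A m k + β * B k

Kcol : ℕ → ℕ → ℕ → ℚ
Kcol m j k = Kentry m k j

module _ (p : ℕ) where

  private
    m = suc p

  Kcol-upper : ∀ {b k} → k ≤ suc b → suc b ≤ p → Kcol m (suc b) k ≡ affine m (ι 2 * (B m - A m (suc b))) (- ι 2) (A m (suc b)) k
  Kcol-upper {b} {zero} _ _ = trans (K-zero-row p (suc b)) (alg (B m) (A m (suc b)))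
    where
    alg : ∀ L aⱼ → 0ℚ ≡ ι 2 * (L - aⱼ) + - ι 2 * L + aⱼ * ι 2
    alg = solve-∀ ℚ-ring
  Kcol-upper {b} {suc a} (s≤s a≤b) 1+b≤p = trans (K-upper p a≤b 1+b≤p) (alg (B m) (A m (suc a)) (A m (suc b)) (B (suc a)))
    where
    alg : ∀ L aᵢ aⱼ bᵢ → ι 2 * (L - aᵢ) + aⱼ * (bᵢ - ι 2) ≡ ι 2 * (L - aⱼ) + - ι 2 * aᵢ + aⱼ * bᵢ
    alg = solve-∀ ℚ-ring

  private
    lower-affine : ∀ L aⱼ bⱼ aᵢ bᵢ → ι 2 * (L - aⱼ) + aᵢ * (bⱼ - ι 2) ≡ ι 2 * (L - aⱼ) + (bⱼ - ι 2) * aᵢ + 0ℚ * bᵢ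
    lower-affine = solve-∀ ℚ-ring

  Kcol-lower : ∀ {b k} → suc b ≤ k → k ≤ m → suc b ≤ p → Kcol m (suc b) k ≡ affine m (ι 2 * (B m - A m (suc b))) (B (suc b) - ι 2) 0ℚ k
  Kcol-lower {b} {suc a} (s≤s b≤a) 1+a≤m 1+b≤p = by-cases (ℕₚ.m≤n⇒m<n∨m≡n b≤a) 1+a≤m 1+b≤p
    where
    by-cases : ∀ {a b} → b < a ⊎ b ≡ a → suc a ≤ m → suc b ≤ p →
               Kcol m (suc b) (suc a) ≡ affine m (ι 2 * (B m - A m (suc b))) (B (suc b) - ι 2) 0ℚ (suc a)
    by-cases {a} {b} (inj₁ b<a) 1+a≤m _ = trans (K-lower p b<a 1+a≤m) (lower-affine (B m) (A m (suc b)) (B (suc b)) (A m (suc a)) (B (suc a)))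
    by-cases {a} {b} (inj₂ refl) _ 1+b≤p = trans (K-upper p ℕₚ.≤-refl 1+b≤p) (lower-affine (B m) (A m (suc b)) (B (suc b)) (A m (suc b)) (B (suc b)))

  Kcol-middle : ∀ {k} → k ≤ m → Kcol m m k ≡ affine m (B m - ι 2) (- 1ℚ) 1ℚ k
  Kcol-middle {zero} _ = trans (K-zero-row p m) (alg (B m))
    where
    alg : ∀ L → 0ℚ ≡ L - ι 2 + - 1ℚ * L + 1ℚ * ι 2
    alg = solve-∀ ℚ-ring
  Kcol-middle {suc a} 1+a≤m = trans (K-middle-col p 1+a≤m) (alg (B m) (A m (suc a)) (B (suc a)))
    where
    alg : ∀ L aᵢ bᵢ → L - aᵢ + bᵢ - ι 2 ≡ L - ι 2 + - 1ℚ * aᵢ + 1ℚ * bᵢ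
    alg = solve-∀ ℚ-ring

  Kcol-last : ∀ {k} → k ≤ m → Kcol m (suc m) k ≡ affine m (B m) (- 1ℚ) 0ℚ k
  Kcol-last {zero} _ = trans (K-zero-row p (suc m)) (alg (B m))
    where
    alg : ∀ L → 0ℚ ≡ L + - 1ℚ * L + 0ℚ * ι 2
    alg = solve-∀ ℚ-ring
  Kcol-last {suc a} 1+a≤m = trans (K-last-col p 1+a≤m) (alg (B m) (A m (suc a)) (B (suc a)))
    where
    alg : ∀ L aᵢ bᵢ → L - aᵢ ≡ L + - 1ℚ * aᵢ + 0ℚ * bᵢ
    alg = solve-∀ ℚ-ring

  Δ-affine : ∀ {a} c α β → suc (suc a) ≤ m → Δ (affine m c α β) a ≡ c
  Δ-affine {a} c α β a+2≤m = begin
    ι 3 * affine m c α β (suc a) - affine m c α β a - (c + α * A m (suc (suc a)) + β * B (suc (suc a)))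
      ≡⟨ cong₂ (λ u v → ι 3 * affine m c α β (suc a) - affine m c α β a - (c + α * u + β * v)) (A-recurrence a+2≤m) (B-recurrence a) ⟩
    ι 3 * (c + α * a₁ + β * b₁) - (c + α * a₀ + β * b₀) - (c + α * (ι 3 * a₁ - a₀) + β * (ι 3 * b₁ - b₀))
      ≡⟨ alg c α β a₀ a₁ b₀ b₁ ⟩
    c ∎
    where
    a₀ = A m a
    a₁ = A m (suc a)
    b₀ = B a
    b₁ = B (suc a)
    alg : ∀ c α β a₀ a₁ b₀ b₁ →
          ι 3 * (c + α * a₁ + β * b₁) - (c + α * a₀ + β * b₀) - (c + α * (ι 3 * a₁ - a₀) + β * (ι 3 * b₁ - b₀)) ≡ c
    alg = solve-∀ ℚ-ring

  affine-middle-row : ∀ c α β → ι 3 * affine m c α β m - ι 2 * affine m c α β p ≡ c + β * D m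
  affine-middle-row c α β = begin
    ι 3 * (c + α * A m m + β * B m) - ι 2 * (c + α * A m p + β * B p)
      ≡⟨ cong₂ (λ u v → ι 3 * (c + α * u + β * B m) - ι 2 * (c + α * v + β * B p)) (A-at-m m) (A-at-pred p) ⟩
    ι 3 * (c + α * ι 2 + β * B m) - ι 2 * (c + α * ι 3 + β * B p)
      ≡⟨ alg c α β (B p) (B m) ⟩
    c + β * (ι 3 * B m - ι 2 * B p)
      ≡⟨ cong (λ u → c + β * (u * B m - ι 2 * B p)) (sym (A-at-pred p)) ⟩
    c + β * (A m p * B m - ι 2 * B p)
      ≡⟨ cong (λ u → c + β * (A m p * B m - u * B p)) (sym (A-at-m m)) ⟩
    c + β * Casoratian (A m) B p
      ≡⟨ cong (λ u → c + β * u) (Casoratian-A-B p ℕₚ.≤-refl) ⟩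
    c + β * D m ∎
    where
    alg : ∀ c α β b₀ b₁ → ι 3 * (c + α * ι 2 + β * b₁) - ι 2 * (c + α * ι 3 + β * b₀) ≡ c + β * (ι 3 * b₁ - ι 2 * b₀)
    alg = solve-∀ ℚ-ring

  affine-first-row : ∀ c α β → ι 2 * affine m c α β 1 + c ≡ - α * D m + ι 3 * affine m c α β 0
  affine-first-row c α β = begin
    ι 2 * (c + α * A m 1 + β * ι 3) + c
      ≡⟨ alg c α β (B m) (A m 1) ⟩
    - α * (B m * ι 3 - A m 1 * ι 2) + ι 3 * (c + α * B m + β * ι 2)
      ≡⟨ cong (λ u → - α * u + ι 3 * affine m c α β 0) (Casoratian-A-B p z≤n) ⟩
    - α * D m + ι 3 * affine m c α β 0 ∎
    where
    alg : ∀ c α β L a₁ → ι 2 * (c + α * a₁ + β * ι 3) + c ≡ - α * (L * ι 3 - a₁ * ι 2) + ι 3 * (c + α * L + β * ι 2)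
    alg = solve-∀ ℚ-ring

off-diagonal : ∀ {u v c} d {i j} → u ≡ c → v ≡ c → i ≢ j → u - v ≡ d * δ i j
off-diagonal {c = c} d refl refl i≢j = trans (ℚₚ.+-inverseʳ c) (sym (trans (cong (d *_) (δ-≢ i≢j)) (ℚₚ.*-zeroʳ d)))

on-diagonal : ∀ {u v c} d i → u ≡ c + d → v ≡ c → u - v ≡ d * δ i i
on-diagonal {c = c} d i refl refl = trans (alg c d) (sym (trans (cong (d *_) (δ-refl i)) (ℚₚ.*-identityʳ d)))
  where
  alg : ∀ c d → c + d - c ≡ d
  alg = solve-∀ ℚ-ring

module _ (p : ℕ) where

  private
    m = suc p

  Kcol-inner-row-above : ∀ {a b} → suc b < m → a < p → a < b →
                         Δ (Kcol m (suc b)) a - Kcol m (suc b) (suc m) ≡ D m * δ (suc a) (suc b)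
  Kcol-inner-row-above {a} {b} 1+b<m a<p a<b =
    off-diagonal (D m) (trans (Δ-values (Kcol m (suc b)) a (Kcol-upper p (ℕₚ.m≤n⇒m≤1+n (ℕₚ.<⇒≤ a<b)) 1+b≤p)
                                                             (Kcol-upper p (s≤s (ℕₚ.<⇒≤ a<b)) 1+b≤p)
                                                             (Kcol-upper p (s≤s a<b) 1+b≤p))
                              (Δ-affine p (ι 2 * (B m - A m (suc b))) (- ι 2) (A m (suc b)) (s≤s a<p)))
                       (K-last-inner p 1+b≤p) (ℕₚ.<⇒≢ (s≤s a<b))
    where 1+b≤p = ℕₚ.≤-pred 1+b<m

  Kcol-inner-row-below : ∀ {a b} → suc b < m → a < p → b < a →
                         Δ (Kcol m (suc b)) a - Kcol m (suc b) (suc m) ≡ D m * δ (suc a) (suc b)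
  Kcol-inner-row-below {a} {b} 1+b<m a<p b<a =
    off-diagonal (D m) (trans (Δ-values (Kcol m (suc b)) a (Kcol-lower p b<a a≤m 1+b≤p)
                                                             (Kcol-lower p (ℕₚ.m≤n⇒m≤1+n b<a) a<m 1+b≤p)
                                                             (Kcol-lower p (ℕₚ.m≤n⇒m≤1+n (ℕₚ.m≤n⇒m≤1+n b<a)) (s≤s a<p) 1+b≤p))
                              (Δ-affine p (ι 2 * (B m - A m (suc b))) (B (suc b) - ι 2) 0ℚ (s≤s a<p)))
                       (K-last-inner p 1+b≤p) (ℕₚ.>⇒≢ (s≤s b<a))
    where
    1+b≤p = ℕₚ.≤-pred 1+b<m
    a<m = ℕₚ.m<n⇒m<1+n a<p
    a≤m = ℕₚ.<⇒≤ a<m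

  Kcol-inner-row-kink : ∀ {a} → a < p → Δ (Kcol m (suc a)) a - Kcol m (suc a) (suc m) ≡ D m * δ (suc a) (suc a)
  Kcol-inner-row-kink {a} a<p = on-diagonal (D m) (suc a) kink (K-last-inner p a<p)
    where
    c = ι 2 * (B m - A m (suc a))
    φ₁ = affine m c (- ι 2) (A m (suc a))
    φ₂ = affine m c (B (suc a) - ι 2) 0ℚ
    jump : φ₁ (suc (suc a)) - φ₂ (suc (suc a)) ≡ Casoratian (A m) B (suc a)
    jump = alg c (A m (suc a)) (A m (suc (suc a))) (B (suc a)) (B (suc (suc a)))
      where
      alg : ∀ c a₁ a₂ b₁ b₂ → (c + - ι 2 * a₂ + a₁ * b₂) - (c + (b₁ - ι 2) * a₂ + 0ℚ * b₂) ≡ a₁ * b₂ - a₂ * b₁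
      alg = solve-∀ ℚ-ring
    kink : Δ (Kcol m (suc a)) a ≡ c + D m
    kink = begin
      Δ (Kcol m (suc a)) a
        ≡⟨ Δ-values (Kcol m (suc a)) a (Kcol-upper p (ℕₚ.n≤1+n a) a<p) (Kcol-upper p ℕₚ.≤-refl a<p)
                                       (Kcol-lower p (ℕₚ.n≤1+n (suc a)) (s≤s a<p) a<p) ⟩
      ι 3 * φ₁ (suc a) - φ₁ a - φ₂ (suc (suc a))
        ≡⟨ alg (φ₁ a) (φ₁ (suc a)) (φ₁ (suc (suc a))) (φ₂ (suc (suc a))) ⟩
      Δ φ₁ a + (φ₁ (suc (suc a)) - φ₂ (suc (suc a)))
        ≡⟨ cong₂ _+_ (Δ-affine p c (- ι 2) (A m (suc a)) (s≤s a<p)) (trans jump (Casoratian-A-B p a<p)) ⟩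
      c + D m ∎
      where
      alg : ∀ u₀ u₁ u₂ v₂ → ι 3 * u₁ - u₀ - v₂ ≡ ι 3 * u₁ - u₀ - u₂ + (u₂ - v₂)
      alg = solve-∀ ℚ-ring

  private
    Kcol-inner-row-by-position : ∀ {a b} → suc b < m → a < p → Tri (a < b) (a ≡ b) (b < a) →
                           Δ (Kcol m (suc b)) a - Kcol m (suc b) (suc m) ≡ D m * δ (suc a) (suc b)
    Kcol-inner-row-by-position 1+b<m a<p (tri< a<b _ _) = Kcol-inner-row-above 1+b<m a<p a<b
    Kcol-inner-row-by-position 1+b<m a<p (tri≈ _ refl _) = Kcol-inner-row-kink a<p
    Kcol-inner-row-by-position 1+b<m a<p (tri> _ _ b<a) = Kcol-inner-row-below 1+b<m a<p b<a

  Kcol-inner-row : ∀ {j a} → Index m j → a < p → Δ (Kcol m j) a - Kcol m j (suc m) ≡ D m * δ (suc a) j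
  Kcol-inner-row {_} {a} (inner {b} 1+b<m) a<p = Kcol-inner-row-by-position 1+b<m a<p (ℕₚ.<-cmp a b)
  Kcol-inner-row {_} {a} middle a<p =
    off-diagonal (D m) (trans (Δ-values (Kcol m m) a (Kcol-middle p (ℕₚ.≤-trans (ℕₚ.n≤1+n a) (s≤s (ℕₚ.<⇒≤ a<p))))
                                                   (Kcol-middle p (s≤s (ℕₚ.<⇒≤ a<p))) (Kcol-middle p (s≤s a<p)))
                              (Δ-affine p (B m - ι 2) (- 1ℚ) 1ℚ (s≤s a<p)))
                       (K-last-middle p) (ℕₚ.<⇒≢ (s≤s a<p))
  Kcol-inner-row {_} {a} last a<p =
    off-diagonal (D m) (trans (Δ-values (Kcol m (suc m)) a (Kcol-last p (ℕₚ.≤-trans (ℕₚ.n≤1+n a) (s≤s (ℕₚ.<⇒≤ a<p))))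
                                                   (Kcol-last p (s≤s (ℕₚ.<⇒≤ a<p))) (Kcol-last p (s≤s a<p)))
                              (Δ-affine p (B m) (- 1ℚ) 0ℚ (s≤s a<p)))
                       (K-last-last p) (ℕₚ.<⇒≢ (s≤s (ℕₚ.m<n⇒m<1+n a<p)))

  Kcol-middle-row : ∀ {j} → Index m j → ι 3 * Kcol m j m - ι 2 * Kcol m j p - Kcol m j (suc m) ≡ D m * δ m j
  Kcol-middle-row (inner {b} 1+b<m) =
    off-diagonal (D m) (begin
      ι 3 * Kcol m (suc b) m - ι 2 * Kcol m (suc b) p
        ≡⟨ cong₂ (λ u v → ι 3 * u - ι 2 * v) (Kcol-lower p (ℕₚ.<⇒≤ 1+b<m) ℕₚ.≤-refl 1+b≤p) (Kcol-lower p 1+b≤p (ℕₚ.n≤1+n p) 1+b≤p) ⟩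
      ι 3 * φ m - ι 2 * φ p
        ≡⟨ affine-middle-row p c α 0ℚ ⟩
      c + 0ℚ * D m
        ≡⟨ trans (cong (c +_) (ℚₚ.*-zeroˡ (D m))) (ℚₚ.+-identityʳ c) ⟩
      c ∎)
      (K-last-inner p 1+b≤p) (ℕₚ.>⇒≢ 1+b<m)
    where
    1+b≤p = ℕₚ.≤-pred 1+b<m
    c = ι 2 * (B m - A m (suc b))
    α = B (suc b) - ι 2
    φ = affine m c α 0ℚ
  Kcol-middle-row middle =
    on-diagonal (D m) m (begin
      ι 3 * Kcol m m m - ι 2 * Kcol m m p
        ≡⟨ cong₂ (λ u v → ι 3 * u - ι 2 * v) (Kcol-middle p ℕₚ.≤-refl) (Kcol-middle p (ℕₚ.n≤1+n p)) ⟩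
      ι 3 * φ m - ι 2 * φ p
        ≡⟨ affine-middle-row p (B m - ι 2) (- 1ℚ) 1ℚ ⟩
      B m - ι 2 + 1ℚ * D m
        ≡⟨ cong (B m - ι 2 +_) (ℚₚ.*-identityˡ (D m)) ⟩
      B m - ι 2 + D m ∎)
      (K-last-middle p)
    where
    φ = affine m (B m - ι 2) (- 1ℚ) 1ℚ
  Kcol-middle-row last =
    off-diagonal (D m) (begin
      ι 3 * Kcol m (suc m) m - ι 2 * Kcol m (suc m) p
        ≡⟨ cong₂ (λ u v → ι 3 * u - ι 2 * v) (Kcol-last p ℕₚ.≤-refl) (Kcol-last p (ℕₚ.n≤1+n p)) ⟩
      ι 3 * φ m - ι 2 * φ p
        ≡⟨ affine-middle-row p (B m) (- 1ℚ) 0ℚ ⟩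
      B m + 0ℚ * D m
        ≡⟨ trans (cong (B m +_) (ℚₚ.*-zeroˡ (D m))) (ℚₚ.+-identityʳ (B m)) ⟩
      B m ∎)
      (K-last-last p) (ℕₚ.<⇒≢ (ℕₚ.n<1+n m))
    where
    φ = affine m (B m) (- 1ℚ) 0ℚ

  applyH-Kcol-inner : ∀ {a j} → a < p → Index m j → applyH m (Kcol m j) (suc a) ≡ D m * δ (suc a) j
  applyH-Kcol-inner {a} {j} a<p J = trans (applyH-inner {m} {a} (Kcol m j) (s≤s a<p)) (Kcol-inner-row J a<p)

  applyH-Kcol-middle : ∀ {j} → Index m j → applyH m (Kcol m j) m ≡ D m * δ m j
  applyH-Kcol-middle {j} J = trans (applyH-middle p (Kcol m j)) (Kcol-middle-row J)

  private
    last-row : ∀ {j} → Index m j → ∀ c α β →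
               Kcol m j 0 ≡ affine m c α β 0 → Kcol m j 1 ≡ affine m c α β 1 → Kcol m j (suc m) ≡ c →
               applyH m (Kcol m j) (suc m) ≡ - α * D m - ι 2 * (D m * ∑ p (λ a → δ (suc a) j)) - D m * δ m j
    last-row {j} J c α β x₀≡φ₀ x₁≡φ₁ x₊≡c = begin
      R₊                                                   ≡⟨ isolate R₊ S Rₘ ⟩
      R₊ + ι 2 * S + Rₘ - ι 2 * S - Rₘ                      ≡⟨ cong (λ t → t - ι 2 * S - Rₘ) (applyH-weighted-rows p x) ⟩
      ι 2 * x 1 + x (suc m) - ι 2 * x 0 - ι 2 * S - Rₘ      ≡⟨ cong₂ (λ u v → ι 2 * x 1 + x (suc m) - ι 2 * u - ι 2 * v - Rₘ) (K-zero-row p j) inner-rows ⟩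
      ι 2 * x 1 + x (suc m) - ι 2 * 0ℚ - ι 2 * (D m * σ) - Rₘ ≡⟨ cong₂ (λ u v → ι 2 * u + v - ι 2 * 0ℚ - ι 2 * (D m * σ) - Rₘ) x₁≡φ₁ x₊≡c ⟩
      ι 2 * φ 1 + c - ι 2 * 0ℚ - ι 2 * (D m * σ) - Rₘ      ≡⟨ cong (λ t → t - ι 2 * 0ℚ - ι 2 * (D m * σ) - Rₘ) (affine-first-row p c α β) ⟩
      - α * D m + ι 3 * φ 0 - ι 2 * 0ℚ - ι 2 * (D m * σ) - Rₘ ≡⟨ cong₂ (λ u v → - α * D m + ι 3 * u - ι 2 * 0ℚ - ι 2 * (D m * σ) - v) φ₀≡0 (applyH-Kcol-middle J) ⟩
      - α * D m + ι 3 * 0ℚ - ι 2 * 0ℚ - ι 2 * (D m * σ) - D m * δ m j ≡⟨ alg (- α * D m) (ι 2 * (D m * σ)) (D m * δ m j) ⟩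
      - α * D m - ι 2 * (D m * σ) - D m * δ m j            ∎
      where
      x = Kcol m j
      φ = affine m c α β
      σ = ∑ p (λ a → δ (suc a) j)
      R₊ = applyH m x (suc m)
      Rₘ = applyH m x m
      S = ∑ p (λ a → applyH m x (suc a))
      inner-rows : S ≡ D m * σ
      inner-rows = trans (∑-cong (λ a a<p → applyH-Kcol-inner a<p J)) (Σ-*ˡ {p} (D m) (λ a → δ (suc (toℕ a)) j))
      φ₀≡0 : φ 0 ≡ 0ℚ
      φ₀≡0 = trans (sym x₀≡φ₀) (K-zero-row p j)
      isolate : ∀ r s t → r ≡ r + ι 2 * s + t - ι 2 * s - t
      isolate = solve-∀ ℚ-ring
      alg : ∀ u v w → u + ι 3 * 0ℚ - ι 2 * 0ℚ - v - w ≡ u - v - w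
      alg = solve-∀ ℚ-ring

  applyH-Kcol-last : ∀ {j} → Index m j → applyH m (Kcol m j) (suc m) ≡ D m * δ (suc m) j
  applyH-Kcol-last J@(inner {b} 1+b<m) = begin
    applyH m (Kcol m (suc b)) (suc m)
      ≡⟨ last-row J (ι 2 * (B m - A m (suc b))) (- ι 2) (A m (suc b)) (Kcol-upper p z≤n b<p) (Kcol-upper p (s≤s z≤n) b<p) (K-last-inner p b<p) ⟩
    - - ι 2 * D m - ι 2 * (D m * ∑ p (λ a → δ a b)) - D m * δ m (suc b)
      ≡⟨ cong₂ (λ s t → - - ι 2 * D m - ι 2 * (D m * s) - D m * t) (∑-δ-inside b<p) (δ-≢ (ℕₚ.>⇒≢ 1+b<m)) ⟩
    - - ι 2 * D m - ι 2 * (D m * 1ℚ) - D m * 0ℚ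
      ≡⟨ alg (D m) ⟩
    D m * 0ℚ
      ≡⟨ cong (D m *_) (sym (δ-≢ (ℕₚ.>⇒≢ (ℕₚ.m<n⇒m<1+n 1+b<m)))) ⟩
    D m * δ (suc m) (suc b) ∎
    where
    b<p = ℕₚ.≤-pred 1+b<m
    alg : ∀ d → - - ι 2 * d - ι 2 * (d * 1ℚ) - d * 0ℚ ≡ d * 0ℚ
    alg = solve-∀ ℚ-ring
  applyH-Kcol-last middle = begin
    applyH m (Kcol m m) (suc m)
      ≡⟨ last-row middle (B m - ι 2) (- 1ℚ) 1ℚ (Kcol-middle p z≤n) (Kcol-middle p (s≤s z≤n)) (K-last-middle p) ⟩
    - - 1ℚ * D m - ι 2 * (D m * ∑ p (λ a → δ a p)) - D m * δ m m
      ≡⟨ cong₂ (λ s t → - - 1ℚ * D m - ι 2 * (D m * s) - D m * t) (∑-δ-outside {p} {p} ℕₚ.≤-refl) (δ-refl m) ⟩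
    - - 1ℚ * D m - ι 2 * (D m * 0ℚ) - D m * 1ℚ
      ≡⟨ alg (D m) ⟩
    D m * 0ℚ
      ≡⟨ cong (D m *_) (sym (δ-≢ (ℕₚ.>⇒≢ (ℕₚ.n<1+n m)))) ⟩
    D m * δ (suc m) m ∎
    where
    alg : ∀ d → - - 1ℚ * d - ι 2 * (d * 0ℚ) - d * 1ℚ ≡ d * 0ℚ
    alg = solve-∀ ℚ-ring
  applyH-Kcol-last last = begin
    applyH m (Kcol m (suc m)) (suc m)
      ≡⟨ last-row last (B m) (- 1ℚ) 0ℚ (Kcol-last p z≤n) (Kcol-last p (s≤s z≤n)) (K-last-last p) ⟩
    - - 1ℚ * D m - ι 2 * (D m * ∑ p (λ a → δ a (suc p))) - D m * δ m (suc m)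
      ≡⟨ cong₂ (λ s t → - - 1ℚ * D m - ι 2 * (D m * s) - D m * t) (∑-δ-outside (ℕₚ.n≤1+n p)) (δ-≢ (ℕₚ.<⇒≢ (ℕₚ.n<1+n m))) ⟩
    - - 1ℚ * D m - ι 2 * (D m * 0ℚ) - D m * 0ℚ
      ≡⟨ alg (D m) ⟩
    D m * 1ℚ
      ≡⟨ cong (D m *_) (sym (δ-refl (suc m))) ⟩
    D m * δ (suc m) (suc m) ∎
    where
    alg : ∀ d → - - 1ℚ * d - ι 2 * (d * 0ℚ) - d * 0ℚ ≡ d * 1ℚ
    alg = solve-∀ ℚ-ring

  applyH-Kcol : ∀ {i j} → Index m i → Index m j → applyH m (Kcol m j) i ≡ D m * δ i j
  applyH-Kcol (inner 1+a<m) J = applyH-Kcol-inner (ℕₚ.≤-pred 1+a<m) J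
  applyH-Kcol middle J = applyH-Kcol-middle J
  applyH-Kcol last J = applyH-Kcol-last J

H⊗Hinv≡Id : ∀ p i j → (H (suc p) ⊗ Hinv (suc p)) i j ≡ Id (suc (suc p)) i j
H⊗Hinv≡Id p i j = begin
  Σ (suc m) (λ k → Hentry m I (suc (toℕ k)) * (c * Kentry m (suc (toℕ k)) J))
    ≡⟨ Σ-cong {suc m} (λ k → alg (Hentry m I (suc (toℕ k))) c (Kentry m (suc (toℕ k)) J)) ⟩
  Σ (suc m) (λ k → c * g k)
    ≡⟨ Σ-*ˡ {suc m} c g ⟩
  c * Σ (suc m) g
    ≡⟨ cong (c *_) (sym drop-phantom) ⟩
  c * applyH m (Kcol m J) I
    ≡⟨ cong (c *_) (applyH-Kcol p (index-of i) (index-of j)) ⟩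
  c * (D m * δ I J)
    ≡⟨ sym (ℚₚ.*-assoc c (D m) (δ I J)) ⟩
  c * D m * δ I J
    ≡⟨ cong (_* δ I J) (1/n*ι[n]≡1 (den (2 ℕ.* m)) {{den-nz (2 ℕ.* m)}}) ⟩
  1ℚ * δ I J
    ≡⟨ ℚₚ.*-identityˡ (δ I J) ⟩
  δ I J ∎
  where
  m = suc p
  I = suc (toℕ i)
  J = suc (toℕ j)
  c = (ℤ.+ 1 / den (2 ℕ.* m)) {{den-nz (2 ℕ.* m)}}
  g : Fin (suc m) → ℚ
  g k = Hentry m I (suc (toℕ k)) * Kentry m (suc (toℕ k)) J
  drop-phantom : applyH m (Kcol m J) I ≡ Σ (suc m) g
  drop-phantom = begin
    Hentry m I 0 * Kentry m 0 J + Σ (suc m) g     ≡⟨ cong (λ t → Hentry m I 0 * t + Σ (suc m) g) (K-zero-row p J) ⟩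
    Hentry m I 0 * 0ℚ + Σ (suc m) g               ≡⟨ cong (_+ Σ (suc m) g) (ℚₚ.*-zeroʳ (Hentry m I 0)) ⟩
    0ℚ + Σ (suc m) g                              ≡⟨ ℚₚ.+-identityˡ (Σ (suc m) g) ⟩
    Σ (suc m) g                                   ∎
  alg : ∀ h c k → h * (c * k) ≡ c * (h * k)
  alg = solve-∀ ℚ-ring

-- Symmetrization

Symmetrizable : ∀ {n} → (Fin n → ℚ) → Matrix n → Set
Symmetrizable w M = ∀ i j → M i j * w j ≡ w i * M j i

⊗-transpose : ∀ {n} {w : Fin n → ℚ} {M N} → Symmetrizable w M → Symmetrizable w N →
              ∀ i j → (N ⊗ M) i j * w j ≡ w i * (M ⊗ N) j i
⊗-transpose {n} {w} {M} {N} M-sym N-sym i j = begin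
  Σ n (λ k → N i k * M k j) * w j          ≡⟨ ℚₚ.*-comm _ (w j) ⟩
  w j * Σ n (λ k → N i k * M k j)          ≡⟨ sym (Σ-*ˡ {n} (w j) (λ k → N i k * M k j)) ⟩
  Σ n (λ k → w j * (N i k * M k j))        ≡⟨ Σ-cong {n} swap ⟩
  Σ n (λ k → w i * (M j k * N k i))        ≡⟨ Σ-*ˡ {n} (w i) (λ k → M j k * N k i) ⟩
  w i * Σ n (λ k → M j k * N k i)          ∎
  where
  swap : ∀ k → w j * (N i k * M k j) ≡ w i * (M j k * N k i)
  swap k = begin
    w j * (N i k * M k j)        ≡⟨ alg₁ (w j) (N i k) (M k j) ⟩
    N i k * (M k j * w j)        ≡⟨ cong (N i k *_) (M-sym k j) ⟩
    N i k * (w k * M j k)        ≡⟨ sym (ℚₚ.*-assoc (N i k) (w k) (M j k)) ⟩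
    N i k * w k * M j k          ≡⟨ cong (_* M j k) (N-sym i k) ⟩
    w i * N k i * M j k          ≡⟨ alg₂ (w i) (N k i) (M j k) ⟩
    w i * (M j k * N k i)        ∎
    where
    alg₁ : ∀ w x y → w * (x * y) ≡ x * (y * w)
    alg₁ = solve-∀ ℚ-ring
    alg₂ : ∀ w x y → w * x * y ≡ w * (y * x)
    alg₂ = solve-∀ ℚ-ring

Id-symmetrizable : ∀ {n} (w : Fin n → ℚ) → Symmetrizable w (Id n)
Id-symmetrizable w i j with toℕ i ℕₚ.≟ toℕ j
... | yes i≡j with toℕ-injective i≡j
...   | refl = ℚₚ.*-comm (Id _ i i) (w i)
Id-symmetrizable w i j | no i≢j rewrite ≢⇒≡ᵇ≡false i≢j | ≢⇒≡ᵇ≡false (i≢j ∘ sym) =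
  trans (ℚₚ.*-zeroˡ (w j)) (sym (ℚₚ.*-zeroʳ (w i)))

right-inverse⇒left-inverse : ∀ {n} {w : Fin n → ℚ} {M N} → (∀ i → NonZero (w i)) →
                             Symmetrizable w M → Symmetrizable w N →
                             (∀ i j → (M ⊗ N) i j ≡ Id n i j) → ∀ i j → (N ⊗ M) i j ≡ Id n i j
right-inverse⇒left-inverse {w = w} {M} {N} w≢0 M-sym N-sym M⊗N≡Id i j =
  *-cancelʳ (w j) {{w≢0 j}} (begin
    (N ⊗ M) i j * w j      ≡⟨ ⊗-transpose {M = M} {N} M-sym N-sym i j ⟩
    w i * (M ⊗ N) j i      ≡⟨ cong (w i *_) (M⊗N≡Id j i) ⟩
    w i * Id _ j i         ≡⟨ sym (Id-symmetrizable w i j) ⟩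
    Id _ i j * w j         ∎)

weight : ℕ → ℕ → ℚ
weight m i = if i <ᵇ m then 1ℚ else ι 2

weight-nonZero : ∀ m i → NonZero (weight m i)
weight-nonZero m i with i <ᵇ m
... | true = _
... | false = _

module _ (p : ℕ) where

  private
    m = suc p

  weight-inner : ∀ {a} → suc a < m → weight m (suc a) ≡ 1ℚ
  weight-inner 1+a<m = if-true (<⇒<ᵇ≡true 1+a<m)

  weight-middle : weight m m ≡ ι 2
  weight-middle = if-false (≥⇒<ᵇ≡false (ℕₚ.≤-refl {m}))

  weight-last : weight m (suc m) ≡ ι 2
  weight-last = if-false (≥⇒<ᵇ≡false (ℕₚ.n≤1+n m))

  weighted-symmetric : ∀ (E : ℕ → ℕ → ℚ) →
    (∀ {a b} → suc a < m → suc b < m → a < b → E (suc a) (suc b) ≡ E (suc b) (suc a)) →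
    (∀ {a} → suc a < m → E (suc a) m * ι 2 ≡ E m (suc a)) →
    (∀ {a} → suc a < m → E (suc a) (suc m) * ι 2 ≡ E (suc m) (suc a)) →
    E m (suc m) ≡ E (suc m) m →
    ∀ {i k} → Index m i → Index m k → E i k * weight m k ≡ weight m i * E k i
  weighted-symmetric E inner-symmetric inner-middle inner-last middle-last = cases
    where
    inner-inner : ∀ {a b} → suc a < m → suc b < m → a < b →
                  E (suc a) (suc b) * weight m (suc b) ≡ weight m (suc a) * E (suc b) (suc a)
    inner-inner {a} {b} 1+a<m 1+b<m a<b = begin
      E (suc a) (suc b) * weight m (suc b)   ≡⟨ cong (E (suc a) (suc b) *_) (weight-inner 1+b<m) ⟩
      E (suc a) (suc b) * 1ℚ                 ≡⟨ ℚₚ.*-comm (E (suc a) (suc b)) 1ℚ ⟩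
      1ℚ * E (suc a) (suc b)                 ≡⟨ cong₂ _*_ (sym (weight-inner 1+a<m)) (inner-symmetric 1+a<m 1+b<m a<b) ⟩
      weight m (suc a) * E (suc b) (suc a)   ∎
    inner-middle′ : ∀ {a} → suc a < m → E (suc a) m * weight m m ≡ weight m (suc a) * E m (suc a)
    inner-middle′ {a} 1+a<m = begin
      E (suc a) m * weight m m               ≡⟨ cong (E (suc a) m *_) weight-middle ⟩
      E (suc a) m * ι 2                      ≡⟨ inner-middle 1+a<m ⟩
      E m (suc a)                            ≡⟨ sym (ℚₚ.*-identityˡ (E m (suc a))) ⟩
      1ℚ * E m (suc a)                       ≡⟨ cong (_* E m (suc a)) (sym (weight-inner 1+a<m)) ⟩
      weight m (suc a) * E m (suc a)         ∎
    inner-last′ : ∀ {a} → suc a < m → E (suc a) (suc m) * weight m (suc m) ≡ weight m (suc a) * E (suc m) (suc a)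
    inner-last′ {a} 1+a<m = begin
      E (suc a) (suc m) * weight m (suc m)   ≡⟨ cong (E (suc a) (suc m) *_) weight-last ⟩
      E (suc a) (suc m) * ι 2                ≡⟨ inner-last 1+a<m ⟩
      E (suc m) (suc a)                      ≡⟨ sym (ℚₚ.*-identityˡ (E (suc m) (suc a))) ⟩
      1ℚ * E (suc m) (suc a)                 ≡⟨ cong (_* E (suc m) (suc a)) (sym (weight-inner 1+a<m)) ⟩
      weight m (suc a) * E (suc m) (suc a)   ∎
    middle-last′ : E m (suc m) * weight m (suc m) ≡ weight m m * E (suc m) m
    middle-last′ = begin
      E m (suc m) * weight m (suc m)         ≡⟨ cong (E m (suc m) *_) (trans weight-last (sym weight-middle)) ⟩
      E m (suc m) * weight m m               ≡⟨ ℚₚ.*-comm (E m (suc m)) (weight m m) ⟩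
      weight m m * E m (suc m)               ≡⟨ cong (weight m m *_) middle-last ⟩
      weight m m * E (suc m) m               ∎
    flip : ∀ i k → E i k * weight m k ≡ weight m i * E k i → E k i * weight m i ≡ weight m k * E i k
    flip i k balanced = trans (ℚₚ.*-comm (E k i) (weight m i)) (trans (sym balanced) (ℚₚ.*-comm (E i k) (weight m k)))
    cases : ∀ {i k} → Index m i → Index m k → E i k * weight m k ≡ weight m i * E k i
    cases (inner {a} 1+a<m) (inner {b} 1+b<m) with ℕₚ.<-cmp a b
    ... | tri< a<b _ _ = inner-inner 1+a<m 1+b<m a<b
    ... | tri≈ _ refl _ = ℚₚ.*-comm (E (suc a) (suc a)) (weight m (suc a))
    ... | tri> _ _ b<a = flip (suc b) (suc a) (inner-inner 1+b<m 1+a<m b<a)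
    cases (inner 1+a<m) middle = inner-middle′ 1+a<m
    cases (inner 1+a<m) last = inner-last′ 1+a<m
    cases middle (inner {b} 1+b<m) = flip (suc b) m (inner-middle′ 1+b<m)
    cases middle middle = ℚₚ.*-comm (E m m) (weight m m)
    cases middle last = middle-last′
    cases last (inner {b} 1+b<m) = flip (suc b) (suc m) (inner-last′ 1+b<m)
    cases last middle = flip m (suc m) middle-last′
    cases last last = ℚₚ.*-comm (E (suc m) (suc m)) (weight m (suc m))

  H-inner-adjacent : ∀ {a} → suc (suc a) < m → Hentry m (suc a) (suc (suc a)) ≡ Hentry m (suc (suc a)) (suc a)
  H-inner-adjacent 2+a<m = trans (H-inner-succ (ℕₚ.<-trans (ℕₚ.n<1+n _) 2+a<m)) (sym (H-inner-pred 2+a<m))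

  H-inner-distant : ∀ {a b} → suc a < m → suc b < m → suc a < b → Hentry m (suc a) (suc b) ≡ Hentry m (suc b) (suc a)
  H-inner-distant {a} {b} 1+a<m 1+b<m 1+a<b =
    trans (H-inner-zero 1+a<m (ℕₚ.>⇒≢ (ℕₚ.<-trans a<b (ℕₚ.n<1+n b))) (ℕₚ.>⇒≢ (s≤s a<b)) (ℕₚ.>⇒≢ (s≤s 1+a<b))
                              (ℕₚ.<⇒≢ (ℕₚ.<-trans 1+b<m (ℕₚ.n<1+n m))))
          (sym (H-inner-zero 1+b<m (ℕₚ.<⇒≢ 1+a<b) (ℕₚ.<⇒≢ (s≤s a<b)) (ℕₚ.<⇒≢ (ℕₚ.<-trans (s≤s a<b) (ℕₚ.n<1+n (suc b))))
                                   (ℕₚ.<⇒≢ (ℕₚ.<-trans 1+a<m (ℕₚ.n<1+n m)))))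
    where a<b = ℕₚ.<-trans (ℕₚ.n<1+n a) 1+a<b

  private
    H-inner-symmetric′ : ∀ {a b} → suc a < m → suc b < m → suc a < b ⊎ suc a ≡ b →
                         Hentry m (suc a) (suc b) ≡ Hentry m (suc b) (suc a)
    H-inner-symmetric′ 1+a<m 1+b<m (inj₁ 1+a<b) = H-inner-distant 1+a<m 1+b<m 1+a<b
    H-inner-symmetric′ 1+a<m 1+b<m (inj₂ refl) = H-inner-adjacent 1+b<m

  H-inner-symmetric : ∀ {a b} → suc a < m → suc b < m → a < b → Hentry m (suc a) (suc b) ≡ Hentry m (suc b) (suc a)
  H-inner-symmetric 1+a<m 1+b<m a<b = H-inner-symmetric′ 1+a<m 1+b<m (ℕₚ.m≤n⇒m<n∨m≡n a<b)

  H-inner-middle : ∀ {a} → suc a < m → Hentry m (suc a) m * ι 2 ≡ Hentry m m (suc a)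
  H-inner-middle 1+a<m = by-cases 1+a<m (ℕₚ.m≤n⇒m<n∨m≡n (ℕₚ.≤-pred 1+a<m))
    where
    by-cases : ∀ {a} → suc a < m → suc a < p ⊎ suc a ≡ p → Hentry m (suc a) m * ι 2 ≡ Hentry m m (suc a)
    by-cases 1+a<m (inj₂ refl) = trans (cong (_* ι 2) (H-inner-succ 1+a<m)) (sym (H-middle-pred p))
    by-cases {a} 1+a<m (inj₁ 1+a<p) =
      trans (cong (_* ι 2) (H-inner-zero 1+a<m (ℕₚ.>⇒≢ (ℕₚ.<-trans (ℕₚ.n<1+n a) 1+a<m)) (ℕₚ.>⇒≢ 1+a<m) (ℕₚ.>⇒≢ (s≤s 1+a<p))
                                         (ℕₚ.<⇒≢ (ℕₚ.n<1+n m))))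
            (sym (H-middle-zero p (ℕₚ.<⇒≢ 1+a<p) (ℕₚ.<⇒≢ 1+a<m) (ℕₚ.<⇒≢ (ℕₚ.<-trans 1+a<m (ℕₚ.n<1+n m)))))

  H-weighted-symmetric : ∀ {i k} → Index m i → Index m k → Hentry m i k * weight m k ≡ weight m i * Hentry m k i
  H-weighted-symmetric = weighted-symmetric (Hentry m) H-inner-symmetric H-inner-middle
    (λ 1+a<m → trans (cong (_* ι 2) (H-inner-last 1+a<m)) (sym (H-last-inner p 1+a<m)))
    (trans (H-middle-succ p) (sym (H-last-middle p)))

  K-inner-symmetric : ∀ {a b} → suc a < m → suc b < m → a < b → Kentry m (suc a) (suc b) ≡ Kentry m (suc b) (suc a)
  K-inner-symmetric {a} {b} 1+a<m 1+b<m a<b = begin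
    Kcol m (suc b) (suc a)                               ≡⟨ Kcol-upper p (s≤s (ℕₚ.<⇒≤ a<b)) (ℕₚ.≤-pred 1+b<m) ⟩
    affine m (ι 2 * (B m - A m (suc b))) (- ι 2) (A m (suc b)) (suc a)
                                                         ≡⟨ alg (B m) (A m (suc a)) (A m (suc b)) (B (suc a)) (B (suc b)) ⟩
    affine m (ι 2 * (B m - A m (suc a))) (B (suc a) - ι 2) 0ℚ (suc b)
                                                         ≡⟨ sym (Kcol-lower p (s≤s (ℕₚ.<⇒≤ a<b)) (ℕₚ.<⇒≤ 1+b<m) (ℕₚ.≤-pred 1+a<m)) ⟩
    Kcol m (suc a) (suc b)                               ∎
    where
    alg : ∀ L aᵢ aⱼ bᵢ bⱼ → ι 2 * (L - aⱼ) + - ι 2 * aᵢ + aⱼ * bᵢ ≡ ι 2 * (L - aᵢ) + (bᵢ - ι 2) * aⱼ + 0ℚ * bⱼ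
    alg = solve-∀ ℚ-ring

  K-inner-middle : ∀ {a} → suc a < m → Kentry m (suc a) m * ι 2 ≡ Kentry m m (suc a)
  K-inner-middle {a} 1+a<m = begin
    Kcol m m (suc a) * ι 2                                          ≡⟨ cong (_* ι 2) (Kcol-middle p (ℕₚ.<⇒≤ 1+a<m)) ⟩
    (B m - ι 2 + - 1ℚ * A m (suc a) + 1ℚ * B (suc a)) * ι 2        ≡⟨ alg (B m) (A m (suc a)) (B (suc a)) (B m) ⟩
    ι 2 * (B m - A m (suc a)) + (B (suc a) - ι 2) * ι 2 + 0ℚ * B m  ≡⟨ cong (λ t → ι 2 * (B m - A m (suc a)) + (B (suc a) - ι 2) * t + 0ℚ * B m) (sym (A-at-m m)) ⟩
    affine m (ι 2 * (B m - A m (suc a))) (B (suc a) - ι 2) 0ℚ m     ≡⟨ sym (Kcol-lower p (ℕₚ.<⇒≤ 1+a<m) ℕₚ.≤-refl (ℕₚ.≤-pred 1+a<m)) ⟩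
    Kcol m (suc a) m                                                ∎
    where
    alg : ∀ L aᵢ bᵢ bₘ → (L - ι 2 + - 1ℚ * aᵢ + 1ℚ * bᵢ) * ι 2 ≡ ι 2 * (L - aᵢ) + (bᵢ - ι 2) * ι 2 + 0ℚ * bₘ
    alg = solve-∀ ℚ-ring

  K-inner-last : ∀ {a} → suc a < m → Kentry m (suc a) (suc m) * ι 2 ≡ Kentry m (suc m) (suc a)
  K-inner-last {a} 1+a<m = begin
    Kentry m (suc a) (suc m) * ι 2    ≡⟨ cong (_* ι 2) (K-last-col p (ℕₚ.<⇒≤ 1+a<m)) ⟩
    (B m - A m (suc a)) * ι 2         ≡⟨ ℚₚ.*-comm (B m - A m (suc a)) (ι 2) ⟩
    ι 2 * (B m - A m (suc a))         ≡⟨ sym (K-last-inner p (ℕₚ.≤-pred 1+a<m)) ⟩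
    Kentry m (suc m) (suc a)          ∎

  K-middle-last : Kentry m m (suc m) ≡ Kentry m (suc m) m
  K-middle-last = trans (K-last-col p ℕₚ.≤-refl) (trans (cong (λ t → B m - t) (A-at-m m)) (sym (K-last-middle p)))

  K-weighted-symmetric : ∀ {i k} → Index m i → Index m k → Kentry m i k * weight m k ≡ weight m i * Kentry m k i
  K-weighted-symmetric = weighted-symmetric (Kentry m) K-inner-symmetric K-inner-middle K-inner-last K-middle-last

  H-symmetrizable : Symmetrizable (λ k → weight m (suc (toℕ k))) (H m)
  H-symmetrizable i k = H-weighted-symmetric (index-of i) (index-of k)

  Hinv-symmetrizable : Symmetrizable (λ k → weight m (suc (toℕ k))) (Hinv m)
  Hinv-symmetrizable i k = begin
    c * Kentry m I K * weight m K     ≡⟨ ℚₚ.*-assoc c (Kentry m I K) (weight m K) ⟩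
    c * (Kentry m I K * weight m K)   ≡⟨ cong (c *_) (K-weighted-symmetric (index-of i) (index-of k)) ⟩
    c * (weight m I * Kentry m K I)   ≡⟨ alg c (weight m I) (Kentry m K I) ⟩
    weight m I * (c * Kentry m K I)   ∎
    where
    I = suc (toℕ i)
    K = suc (toℕ k)
    c = (ℤ.+ 1 / den (2 ℕ.* m)) {{den-nz (2 ℕ.* m)}}
    alg : ∀ c w x → c * (w * x) ≡ w * (c * x)
    alg = solve-∀ ℚ-ring

-- The hypothesis 2 ≤ m is only used to exclude m = 0; the case m = 1 holds as well.
proposition2 : (m : ℕ) → 2 ≤ m → (i j : Fin (suc m)) →
    ((H m ⊗ Hinv m) i j ≡ Id (suc m) i j) × ((Hinv m ⊗ H m) i j ≡ Id (suc m) i j)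
proposition2 (suc p) _ i j =
  H⊗Hinv≡Id p i j ,
  right-inverse⇒left-inverse {w = λ k → weight (suc p) (suc (toℕ k))} {M = H (suc p)} {N = Hinv (suc p)}
    (λ k → weight-nonZero (suc p) (suc (toℕ k))) (H-symmetrizable p) (Hinv-symmetrizable p) (H⊗Hinv≡Id p) i j
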